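{- For $r\in\{0,1,2\}$ define \begin{align*} F(r)&:=-i(iq^{3/2})^{ -r}q^{\frac12}\frac{J_1^3\,j((-q^3)^{r+1};q^{12})}{J_{2,4}J_{6,12}}+\frac14\frac{J_1^3}{J_2^2}\Big(q^{ -r}\frac{j(q^{2+2r};q^8)}{J_8}j(-q^{1-r};q^4)\Big)\\ &\quad+(iq^{3/2})^{ -1}\Big(q^2\frac{J_1^2J_4J_{12}}{J_2^2J_3}\Big)\Big(-q^{ -r}\frac{j(q^{2+2r};q^8)}{J_8}j(q^{1-r};q^4)\Big). \end{align*} Then $F(0)=\frac14\frac{J_1^2J_2}{J_4}$, $F(1)=-\frac{1}{2q}\frac{J_1^3J_4}{J_2^2}$, and $F(2)=\frac{1}{4q^3}\frac{J_1^2J_2}{J_4}$.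
   Context: $q=e^{2\pi i\tau}$ with $\mathrm{Im}\,\tau>0$, and $q^{a}:=e^{2\pi i a\tau}$ for rational $a$; $i=\sqrt{ -1}$. $(x)_\infty=\prod_{k\ge0}(1-q^kx)$; $j(x;q)=(x)_\infty(q/x)_\infty(q)_\infty$; $J_{a,b}=j(q^a;q^b)$; $J_a=\prod_{k\ge1}(1-q^{ak})$. -}

module Defs where

-- Formal Laurent series in t = q^(1/2) with coefficients in the Gaussian
-- rationals ℚ(i).  The q-series of the paper are encoded here: a term
-- c·q^(k/2) is the monomial c·t^k.

open import Data.Bool using (Bool; true; false; if_then_else_)
open import Data.Nat as ℕ using (ℕ; zero; suc; _∸_; _≤ᵇ_; _≡ᵇ_)
open import Data.Integer as ℤ using (ℤ; +_; -[1+_]; +[1+_])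
open import Data.Rational as ℚ using (ℚ; 0ℚ; 1ℚ)
open import Data.Rational.Properties as ℚP using ()
open import Relation.Binary.PropositionalEquality using (_≡_)
open import Relation.Nullary using (yes; no)

record ℚi : Set where
  constructor _+i_
  field
    re : ℚ
    im : ℚ
open ℚi public

fromℚ : ℚ → ℚi
fromℚ a = a +i 0ℚ

0i 1i iu : ℚi
0i = 0ℚ +i 0ℚ
1i = 1ℚ +i 0ℚ
iu = 0ℚ +i 1ℚ

infixl 6 _⊕_
infixl 7 _⊗_
_⊕_ : ℚi → ℚi → ℚi
(a +i b) ⊕ (c +i d) = (a ℚ.+ c) +i (b ℚ.+ d)

_⊗_ : ℚi → ℚi → ℚi
(a +i b) ⊗ (c +i d) = (a ℚ.* c ℚ.- b ℚ.* d) +i (a ℚ.* d ℚ.+ b ℚ.* c)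

⊖_ : ℚi → ℚi
⊖ (a +i b) = (ℚ.- a) +i (ℚ.- b)

-- multiplicative inverse (inv 0 = 0 by convention; never used at 0)
inv : ℚi → ℚi
inv (a +i b) with (a ℚ.* a ℚ.+ b ℚ.* b) ℚP.≟ 0ℚ
... | yes _ = 0i
... | no p  = ℚ._÷_ a n {{ℚ.≢-nonZero p}} +i ℚ._÷_ (ℚ.- b) n {{ℚ.≢-nonZero p}}
  where n = a ℚ.* a ℚ.+ b ℚ.* b

PS : Set
PS = ℕ → ℚi

sumTo : (ℕ → ℚi) → ℕ → ℚi
sumTo f zero    = 0i
sumTo f (suc n) = sumTo f n ⊕ f n

psMul : PS → PS → PS
psMul f g n = sumTo (λ k → f k ⊗ g (n ∸ k)) (suc n)

-- inverse of a power series with nonzero constant term: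
-- b₀ = a₀⁻¹,  b_{n+1} = - a₀⁻¹ Σ_{m ≤ n} a_{m+1} b_{n-m}.
-- invPre f n agrees with the inverse on indices ≤ n.
invPre : PS → ℕ → PS
invPre f zero    = λ _ → inv (f 0)
invPre f (suc n) = λ k → if k ≤ᵇ n then invPre f n k
  else ⊖ (inv (f 0) ⊗ sumTo (λ m → f (suc m) ⊗ invPre f n (n ∸ m)) (suc n))

psInv : PS → PS
psInv f n = invPre f n n

-- Formal Laurent series:  Σ_{n ≥ 0} co n · t^(sh + n)

record LS : Set where
  constructor ls
  field
    sh : ℤ
    co : PS
open LS public

coeffAt : LS → ℤ → ℚi
coeffAt L e with e ℤ.- sh L
... | + n      = co L n
... | -[1+ _ ] = 0i

infix 4 _≈L_
_≈L_ : LS → LS → Set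
A ≈L B = ∀ (e : ℤ) → coeffAt A e ≡ coeffAt B e

infixl 6 _+L_ _-L_
infixl 7 _*L_ _/L_ _·L_
_+L_ : LS → LS → LS
A +L B = ls m (λ n → coeffAt A (m ℤ.+ + n) ⊕ coeffAt B (m ℤ.+ + n))
  where m = sh A ℤ.⊓ sh B

_·L_ : ℚi → LS → LS
c ·L A = ls (sh A) (λ n → c ⊗ co A n)

-L_ : LS → LS
-L A = (⊖ 1i) ·L A

_-L_ : LS → LS → LS
A -L B = A +L (-L B)

_*L_ : LS → LS → LS
A *L B = ls (sh A ℤ.+ sh B) (psMul (co A) (co B))

-- inverse (meaningful when the coefficient co 0 is nonzero, as for all
-- theta products used below)
invL : LS → LS
invL A = ls (ℤ.- sh A) (psInv (co A))

_/L_ : LS → LS → LS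
A /L B = A *L invL B


record Mono : Set where
  constructor mono
  field
    coef : ℚi
    texp : ℤ
open Mono public

monoL : Mono → LS
monoL (mono c e) = ls e (λ { zero → c ; (suc _) → 0i })

oneL : LS
oneL = monoL (mono 1i (+ 0))

infixr 8 _^L_
_^L_ : LS → ℕ → LS
A ^L zero  = oneL
A ^L suc n = A *L (A ^L n)

ℚL : ℚ → LS
ℚL a = monoL (mono (fromℚ a) (+ 0))

_⊛_ : Mono → Mono → Mono
mono c e ⊛ mono d f = mono (c ⊗ d) (e ℤ.+ f)

monoInv : Mono → Mono
monoInv (mono c e) = mono (inv c) (ℤ.- e)

monoPow : Mono → ℕ → Mono
monoPow x zero    = mono 1i (+ 0)
monoPow x (suc n) = x ⊛ monoPow x n

qp : ℤ → Mono
qp a = mono 1i (+ 2 ℤ.* a)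

qhalf : ℤ → Mono
qhalf k = mono 1i k

factorPS : ℚi → ℕ → PS
factorPS c d n = (if n ≡ᵇ 0 then 1i else 0i) ⊕ (if n ≡ᵇ d then ⊖ c else 0i)

finProd : ℚi → ℕ → ℕ → ℕ → PS
finProd c e B zero    = λ n → if n ≡ᵇ 0 then 1i else 0i
finProd c e B (suc K) = psMul (finProd c e B K) (factorPS c (e ℕ.+ B ℕ.* K))

-- infinite product when e ≥ 1: factors with k ≥ n do not affect the
-- coefficient of t^n (since e + B k ≥ k + 1)
tailPS : ℚi → ℕ → ℕ → PS
tailPS c e B n = finProd c e B (suc n) n

-- peel off the finitely many factors with exponent ≤ 0 (fuel suffices)
peel : ℕ → ℚi → ℤ → ℕ → LS
peel fuel    c +[1+ n ] B = ls (+ 0) (tailPS c (suc n) B)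
peel zero    c e        B = oneL
peel (suc f) c e        B =
  (oneL -L monoL (mono c e)) *L peel f c (e ℤ.+ + B) B

-- (x ; q^b)_∞  for a monomial x and b ≥ 1
poch : Mono → ℕ → LS
poch (mono c e) b = peel (suc ℤ.∣ e ∣) c e (2 ℕ.* b)

jf : Mono → ℕ → LS
jf x b = poch x b *L poch (qp (+ b) ⊛ monoInv x) b *L poch (qp (+ b)) b

Jab : ℤ → ℕ → LS
Jab a b = jf (qp a) b

J : ℕ → LS
J a = poch (qp (+ a)) a

iq32 : Mono
iq32 = mono iu (+ 3)

F : ℕ → LS
F r =
    monoL ((mono (⊖ iu) (+ 0) ⊛ monoPow (monoInv iq32) r) ⊛ qhalf (+ 1))
      *L ((J 1 ^L 3) *L jf (monoPow (mono (⊖ 1i) (+ 6)) (suc r)) 12)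
      /L (Jab (+ 2) 4 *L Jab (+ 6) 12)
  +L ℚL (+ 1 ℚ./ 4) *L ((J 1 ^L 3) /L (J 2 ^L 2))
      *L (monoL (qp (ℤ.- (+ r))) *L (jf (qp (+ 2 ℤ.+ + 2 ℤ.* + r)) 8 /L J 8)
           *L jf (mono (⊖ 1i) (+ 2 ℤ.* (+ 1 ℤ.- + r))) 4)
  +L monoL (monoInv iq32)
      *L (monoL (qp (+ 2)) *L ((J 1 ^L 2) *L J 4 *L J 12) /L ((J 2 ^L 2) *L J 3))
      *L (-L (monoL (qp (ℤ.- (+ r))) *L (jf (qp (+ 2 ℤ.+ + 2 ℤ.* + r)) 8 /L J 8))
           *L jf (qp (+ 1 ℤ.- + r)) 4)

-- At r = 0, 1, 2 each theta function in F(r) is j(x; q^b) = (x)_∞ (q^b/x)_∞ (q^b)_∞ with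
-- x = ±q^a, and each of these Pochhammer symbols is, up to a factor 1 - x when a ≤ 0, a
-- product of factors (1 - q^(k/2))^(±1), by (-y; q)_∞ = (y²; q²)_∞ / (y; q)_∞.  Hence each of
-- the three terms of F(r), and each right-hand side, is c q^(s/2) times an eta quotient
-- Π_{k ≥ 1} (1 - q^(k/2))^(a k) with eventually periodic exponents a.  For r = 0 and r = 2 the
-- first and third terms have the same eta quotient and opposite constants, and the second term
-- equals the right-hand side; for r = 1 the third term vanishes, as it contains j(1; q^4) = 0,
-- and the first two terms have the eta quotient of the right-hand side.  Eventually periodic
-- exponent vectors agree as soon as they agree on one period past the start of periodicity.

module Submission where

open import Defs
open import Algebra.Bundles using (CommutativeRing)
open import Data.Bool using (Bool; true; false; if_then_else_; T; _∧_)
open import Data.Bool.Properties using (T-∧)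
open import Data.Empty using (⊥-elim)
open import Data.Integer as ℤ using (ℤ; +_; -[1+_]; 0ℤ)
import Data.Integer.Properties as ℤP
import Data.Integer.Tactic.RingSolver as ℤ-Solver
open import Data.Nat as ℕ
  using (ℕ; zero; suc; _+_; _*_; _∸_; _≤_; _<_; z≤n; s≤s; _≡ᵇ_; _≤ᵇ_; _<?_; _≤?_; _≟_)
open import Data.Nat.Divisibility
  using (_∣_; _∣?_; ∣-refl; ∣-trans; m∣m*n; ∣⇒≤; ∣m+n∣m⇒∣n; ∣m∣n⇒∣m+n)
open import Data.Nat.Induction using (<-rec)
open import Data.Nat.Properties
open import Data.Nat.Tactic.RingSolver using (solve-∀)
open import Data.Product using (_×_; _,_; proj₁; proj₂)
open import Data.Rational using (0ℚ; _/_)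
import Data.Rational.Properties as ℚP
open import Data.Sum using (inj₁; inj₂)
open import Data.Unit using (tt)
open import Function using (_∘_; Equivalence)
open import Relation.Binary.PropositionalEquality hiding (J)
open import Relation.Nullary using (Dec; yes; no; ¬_; _×-dec_)
open import Relation.Nullary.Decidable using (True; toWitness; dec⇒maybe)
import Tactic.RingSolver as RingSolver
open import Tactic.RingSolver.Core.AlmostCommutativeRing
  using (AlmostCommutativeRing; fromCommutativeRing)

ℚ-ring : AlmostCommutativeRing _ _
ℚ-ring = fromCommutativeRing ℚP.+-*-commutativeRing (λ x → dec⇒maybe (0ℚ ℚP.≟ x))

module _ where
  open import Algebra.Definitions {A = ℚi} (_≡_)
  open import Algebra.Structures {A = ℚi} (_≡_) using (IsCommutativeRing)
  open import Data.Rational using (1ℚ) renaming (_+_ to _+ℚ_; _*_ to _*ℚ_; _-_ to _-ℚ_)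

  ⊕-assoc : Associative _⊕_
  ⊕-assoc (a +i b) (c +i d) (e +i f) = cong₂ _+i_ (ℚP.+-assoc a c e) (ℚP.+-assoc b d f)

  ⊕-comm : Commutative _⊕_
  ⊕-comm (a +i b) (c +i d) = cong₂ _+i_ (ℚP.+-comm a c) (ℚP.+-comm b d)

  ⊕-identityˡ : LeftIdentity 0i _⊕_
  ⊕-identityˡ (a +i b) = cong₂ _+i_ (ℚP.+-identityˡ a) (ℚP.+-identityˡ b)

  ⊕-identityʳ : RightIdentity 0i _⊕_
  ⊕-identityʳ (a +i b) = cong₂ _+i_ (ℚP.+-identityʳ a) (ℚP.+-identityʳ b)

  ⊖-inverseˡ : LeftInverse 0i ⊖_ _⊕_
  ⊖-inverseˡ (a +i b) = cong₂ _+i_ (ℚP.+-inverseˡ a) (ℚP.+-inverseˡ b)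

  ⊖-inverseʳ : RightInverse 0i ⊖_ _⊕_
  ⊖-inverseʳ (a +i b) = cong₂ _+i_ (ℚP.+-inverseʳ a) (ℚP.+-inverseʳ b)

  ⊗-assoc : Associative _⊗_
  ⊗-assoc (a +i b) (c +i d) (e +i f) = cong₂ _+i_ (re-assoc a b c d e f) (im-assoc a b c d e f)
    where
    re-assoc : ∀ a b c d e f →
      (a *ℚ c -ℚ b *ℚ d) *ℚ e -ℚ (a *ℚ d +ℚ b *ℚ c) *ℚ f
        ≡ a *ℚ (c *ℚ e -ℚ d *ℚ f) -ℚ b *ℚ (c *ℚ f +ℚ d *ℚ e)
    re-assoc = RingSolver.solve-∀ ℚ-ring
    im-assoc : ∀ a b c d e f →
      (a *ℚ c -ℚ b *ℚ d) *ℚ f +ℚ (a *ℚ d +ℚ b *ℚ c) *ℚ e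
        ≡ a *ℚ (c *ℚ f +ℚ d *ℚ e) +ℚ b *ℚ (c *ℚ e -ℚ d *ℚ f)
    im-assoc = RingSolver.solve-∀ ℚ-ring

  ⊗-comm : Commutative _⊗_
  ⊗-comm (a +i b) (c +i d) =
    cong₂ _+i_ (cong₂ _-ℚ_ (ℚP.*-comm a c) (ℚP.*-comm b d))
               (trans (ℚP.+-comm (a *ℚ d) (b *ℚ c)) (cong₂ _+ℚ_ (ℚP.*-comm b c) (ℚP.*-comm a d)))

  ⊗-identityˡ : LeftIdentity 1i _⊗_
  ⊗-identityˡ (a +i b) = cong₂ _+i_ (re-identity a b) (im-identity a b)
    where
    re-identity : ∀ a b → 1ℚ *ℚ a -ℚ 0ℚ *ℚ b ≡ a
    re-identity = RingSolver.solve-∀ ℚ-ring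
    im-identity : ∀ a b → 1ℚ *ℚ b +ℚ 0ℚ *ℚ a ≡ b
    im-identity = RingSolver.solve-∀ ℚ-ring

  ⊗-identityʳ : RightIdentity 1i _⊗_
  ⊗-identityʳ x = trans (⊗-comm x 1i) (⊗-identityˡ x)

  ⊗-distribˡ-⊕ : _⊗_ DistributesOverˡ _⊕_
  ⊗-distribˡ-⊕ (a +i b) (c +i d) (e +i f) =
    cong₂ _+i_ (re-distrib a b c d e f) (im-distrib a b c d e f)
    where
    re-distrib : ∀ a b c d e f →
      a *ℚ (c +ℚ e) -ℚ b *ℚ (d +ℚ f) ≡ (a *ℚ c -ℚ b *ℚ d) +ℚ (a *ℚ e -ℚ b *ℚ f)
    re-distrib = RingSolver.solve-∀ ℚ-ring
    im-distrib : ∀ a b c d e f →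
      a *ℚ (d +ℚ f) +ℚ b *ℚ (c +ℚ e) ≡ (a *ℚ d +ℚ b *ℚ c) +ℚ (a *ℚ f +ℚ b *ℚ e)
    im-distrib = RingSolver.solve-∀ ℚ-ring

  ⊗-distribʳ-⊕ : _⊗_ DistributesOverʳ _⊕_
  ⊗-distribʳ-⊕ x y z =
    trans (⊗-comm (y ⊕ z) x) (trans (⊗-distribˡ-⊕ x y z) (cong₂ _⊕_ (⊗-comm x y) (⊗-comm x z)))

  ℚi-isCommutativeRing : IsCommutativeRing _⊕_ _⊗_ ⊖_ 0i 1i
  ℚi-isCommutativeRing = record
    { isRing = record
      { +-isAbelianGroup = record
        { isGroup = record
          { isMonoid = record
            { isSemigroup = record
              { isMagma = record { isEquivalence = isEquivalence ; ∙-cong = cong₂ _⊕_ }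
              ; assoc = ⊕-assoc }
            ; identity = ⊕-identityˡ , ⊕-identityʳ }
          ; inverse = ⊖-inverseˡ , ⊖-inverseʳ
          ; ⁻¹-cong = cong ⊖_ }
        ; comm = ⊕-comm }
      ; *-cong = cong₂ _⊗_
      ; *-assoc = ⊗-assoc
      ; *-identity = ⊗-identityˡ , ⊗-identityʳ
      ; distrib = ⊗-distribˡ-⊕ , ⊗-distribʳ-⊕ }
    ; *-comm = ⊗-comm }

_≟ᵢ_ : (x y : ℚi) → Dec (x ≡ y)
(a +i b) ≟ᵢ (c +i d) with a ℚP.≟ c | b ℚP.≟ d
... | yes refl | yes refl = yes refl
... | no a≢c   | _        = no (a≢c ∘ cong re)
... | _        | no b≢d   = no (b≢d ∘ cong im)

ℚi-commutativeRing : CommutativeRing _ _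
ℚi-commutativeRing = record { isCommutativeRing = ℚi-isCommutativeRing }

ℚi-ring : AlmostCommutativeRing _ _
ℚi-ring = fromCommutativeRing ℚi-commutativeRing (λ x → dec⇒maybe (0i ≟ᵢ x))

⊗-zeroˡ : ∀ x → 0i ⊗ x ≡ 0i
⊗-zeroˡ = RingSolver.solve-∀ ℚi-ring

⊗-zeroʳ : ∀ x → x ⊗ 0i ≡ 0i
⊗-zeroʳ = RingSolver.solve-∀ ℚi-ring

sumTo-cong : ∀ {f g} n → (∀ k → k < n → f k ≡ g k) → sumTo f n ≡ sumTo g n
sumTo-cong zero    f≡g = refl
sumTo-cong (suc n) f≡g = cong₂ _⊕_ (sumTo-cong n (λ k k<n → f≡g k (m<n⇒m<1+n k<n))) (f≡g n ≤-refl)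

sumTo-⊕ : ∀ f g n → sumTo (λ k → f k ⊕ g k) n ≡ sumTo f n ⊕ sumTo g n
sumTo-⊕ f g zero    = sym (⊕-identityʳ 0i)
sumTo-⊕ f g (suc n) =
  trans (cong (_⊕ (f n ⊕ g n)) (sumTo-⊕ f g n)) (middle-swap (sumTo f n) (sumTo g n) (f n) (g n))
  where
  middle-swap : ∀ a b c d → (a ⊕ b) ⊕ (c ⊕ d) ≡ (a ⊕ c) ⊕ (b ⊕ d)
  middle-swap = RingSolver.solve-∀ ℚi-ring

⊗-distribˡ-sumTo : ∀ c f n → c ⊗ sumTo f n ≡ sumTo (λ k → c ⊗ f k) n
⊗-distribˡ-sumTo c f zero    = ⊗-zeroʳ c
⊗-distribˡ-sumTo c f (suc n) =
  trans (⊗-distribˡ-⊕ c _ _) (cong (_⊕ (c ⊗ f n)) (⊗-distribˡ-sumTo c f n))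

⊗-distribʳ-sumTo : ∀ c f n → sumTo f n ⊗ c ≡ sumTo (λ k → f k ⊗ c) n
⊗-distribʳ-sumTo c f n =
  trans (⊗-comm _ c) (trans (⊗-distribˡ-sumTo c f n) (sumTo-cong n (λ k _ → ⊗-comm c (f k))))

sumTo-zero : ∀ f n → (∀ k → k < n → f k ≡ 0i) → sumTo f n ≡ 0i
sumTo-zero f zero    f≡0 = refl
sumTo-zero f (suc n) f≡0 =
  trans (cong₂ _⊕_ (sumTo-zero f n (λ k k<n → f≡0 k (m<n⇒m<1+n k<n))) (f≡0 n ≤-refl)) (⊕-identityʳ 0i)

sumTo-sucˡ : ∀ f n → sumTo f (suc n) ≡ f 0 ⊕ sumTo (f ∘ suc) n
sumTo-sucˡ f zero    = trans (⊕-identityˡ (f 0)) (sym (⊕-identityʳ (f 0)))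
sumTo-sucˡ f (suc n) =
  trans (cong (_⊕ f (suc n)) (sumTo-sucˡ f n)) (⊕-assoc (f 0) (sumTo (f ∘ suc) n) (f (suc n)))

sumTo-reverse : ∀ f n → sumTo f n ≡ sumTo (λ k → f (n ∸ suc k)) n
sumTo-reverse f zero    = refl
sumTo-reverse f (suc n) = begin
  sumTo f n ⊕ f n                              ≡⟨ cong (_⊕ f n) (sumTo-reverse f n) ⟩
  sumTo (λ k → f (n ∸ suc k)) n ⊕ f n          ≡⟨ ⊕-comm _ (f n) ⟩
  f n ⊕ sumTo (λ k → f (n ∸ suc k)) n          ≡⟨ sumTo-sucˡ (λ k → f (suc n ∸ suc k)) n ⟨
  sumTo (λ k → f (suc n ∸ suc k)) (suc n)      ∎
  where open ≡-Reasoning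

sumTo-single : ∀ f n j → j < n → (∀ k → k < n → k ≢ j → f k ≡ 0i) → sumTo f n ≡ f j
sumTo-single f (suc n) j j<1+n others with m≤n⇒m<n∨m≡n (≤-pred j<1+n)
... | inj₁ j<n  = trans (cong₂ _⊕_ (sumTo-single f n j j<n (λ k k<n → others k (m<n⇒m<1+n k<n)))
                                    (others n ≤-refl (λ n≡j → <⇒≢ j<n (sym n≡j))))
                        (⊕-identityʳ (f j))
... | inj₂ refl = trans (cong (_⊕ f j) (sumTo-zero f n (λ k k<n → others k (m<n⇒m<1+n k<n) (<⇒≢ k<n))))
                        (⊕-identityˡ (f j))

sumTo-triangle : ∀ (F : ℕ → ℕ → ℚi) n →
  sumTo (λ k → sumTo (λ i → F i k) (suc k)) n ≡ sumTo (λ i → sumTo (λ j → F i (i + j)) (n ∸ i)) n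
sumTo-triangle F zero    = refl
sumTo-triangle F (suc n) = begin
  sumTo (λ k → sumTo (λ i → F i k) (suc k)) n ⊕ sumTo (λ i → F i n) (suc n)
    ≡⟨ cong (_⊕ sumTo (λ i → F i n) (suc n)) (sumTo-triangle F n) ⟩
  Rows n ⊕ (sumTo (λ i → F i n) n ⊕ F n n)
    ≡⟨ ⊕-assoc (Rows n) (sumTo (λ i → F i n) n) (F n n) ⟨
  (Rows n ⊕ sumTo (λ i → F i n) n) ⊕ F n n
    ≡⟨ cong₂ _⊕_ (sumTo-⊕ (λ i → Row i (n ∸ i)) (λ i → F i n) n) last-row ⟨
  sumTo (λ i → Row i (n ∸ i) ⊕ F i n) n ⊕ Row n (suc n ∸ n)
    ≡⟨ cong (_⊕ Row n (suc n ∸ n)) (sumTo-cong n (λ i i<n → sym (longer-row i i<n))) ⟩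
  sumTo (λ i → Row i (suc n ∸ i)) n ⊕ Row n (suc n ∸ n)
    ∎
  where
  open ≡-Reasoning
  Row : ℕ → ℕ → ℚi
  Row i = sumTo (λ j → F i (i + j))
  Rows : ℕ → ℚi
  Rows m = sumTo (λ i → Row i (m ∸ i)) m
  longer-row : ∀ i → i < n → Row i (suc n ∸ i) ≡ Row i (n ∸ i) ⊕ F i n
  longer-row i i<n = begin
    Row i (suc n ∸ i)              ≡⟨ cong (Row i) (+-∸-assoc 1 (<⇒≤ i<n)) ⟩
    Row i (n ∸ i) ⊕ F i (i + (n ∸ i)) ≡⟨ cong (λ m → Row i (n ∸ i) ⊕ F i m) (m+[n∸m]≡n (<⇒≤ i<n)) ⟩
    Row i (n ∸ i) ⊕ F i n          ∎
  last-row : Row n (suc n ∸ n) ≡ F n n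
  last-row = begin
    Row n (suc n ∸ n)  ≡⟨ cong (Row n) (trans (+-∸-assoc 1 (≤-refl {n})) (cong suc (n∸n≡0 n))) ⟩
    0i ⊕ F n (n + 0)   ≡⟨ ⊕-identityˡ _ ⟩
    F n (n + 0)        ≡⟨ cong (F n) (+-identityʳ n) ⟩
    F n n              ∎

if-T : ∀ {A : Set} {b} {x y : A} → T b → (if b then x else y) ≡ x
if-T {b = true} _ = refl

if-¬T : ∀ {A : Set} {b} {x y : A} → ¬ T b → (if b then x else y) ≡ y
if-¬T {b = false} _  = refl
if-¬T {b = true}  ¬T = ⊥-elim (¬T tt)

≡ᵇ-refl : ∀ n → (n ≡ᵇ n) ≡ true
≡ᵇ-refl zero    = refl
≡ᵇ-refl (suc n) = ≡ᵇ-refl n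

≢⇒≡ᵇ-false : ∀ {m n} → m ≢ n → (m ≡ᵇ n) ≡ false
≢⇒≡ᵇ-false {m} {n} m≢n with m ≡ᵇ n in m≡ᵇn
... | false = refl
... | true  = ⊥-elim (m≢n (≡ᵇ⇒≡ m n (subst T (sym m≡ᵇn) tt)))

≡ᵇ-+ˡ : ∀ a x y → (a + x ≡ᵇ a + y) ≡ (x ≡ᵇ y)
≡ᵇ-+ˡ zero    x y = refl
≡ᵇ-+ˡ (suc a) x y = ≡ᵇ-+ˡ a x y

psOne : PS
psOne n = if n ≡ᵇ 0 then 1i else 0i

infixr 7 _·P_
_·P_ : ℚi → PS → PS
(c ·P f) n = c ⊗ f n

psMul-cong : ∀ {f f′ g g′} → f ≗ f′ → g ≗ g′ → psMul f g ≗ psMul f′ g′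
psMul-cong f≗f′ g≗g′ n = sumTo-cong (suc n) (λ k _ → cong₂ _⊗_ (f≗f′ k) (g≗g′ (n ∸ k)))

psMul-congˡ : ∀ {f f′} g → f ≗ f′ → psMul f g ≗ psMul f′ g
psMul-congˡ g f≗f′ = psMul-cong {g = g} f≗f′ (λ _ → refl)

psMul-congʳ : ∀ f {g g′} → g ≗ g′ → psMul f g ≗ psMul f g′
psMul-congʳ f g≗g′ = psMul-cong {f = f} (λ _ → refl) g≗g′

psMul-comm : ∀ f g → psMul f g ≗ psMul g f
psMul-comm f g n = trans (sumTo-reverse _ (suc n)) (sumTo-cong (suc n) λ k k<1+n →
  trans (cong (λ m → f (n ∸ k) ⊗ g m) (m∸[m∸n]≡n (≤-pred k<1+n))) (⊗-comm (f (n ∸ k)) (g k)))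

psMul-identityʳ : ∀ f → psMul f psOne ≗ f
psMul-identityʳ f n = begin
  psMul f psOne n        ≡⟨ sumTo-single _ (suc n) n ≤-refl off-diagonal ⟩
  f n ⊗ psOne (n ∸ n)    ≡⟨ cong (λ m → f n ⊗ psOne m) (n∸n≡0 n) ⟩
  f n ⊗ 1i               ≡⟨ ⊗-identityʳ (f n) ⟩
  f n                    ∎
  where
  open ≡-Reasoning
  off-diagonal : ∀ k → k < suc n → k ≢ n → f k ⊗ psOne (n ∸ k) ≡ 0i
  off-diagonal k k<1+n k≢n with n ∸ k in n∸k≡m
  ... | zero  = ⊥-elim (k≢n (≤-antisym (≤-pred k<1+n) (m∸n≡0⇒m≤n n∸k≡m)))
  ... | suc m = ⊗-zeroʳ (f k)

psMul-identityˡ : ∀ f → psMul psOne f ≗ f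
psMul-identityˡ f n = trans (psMul-comm psOne f n) (psMul-identityʳ f n)

psMul-·ˡ : ∀ c f g → psMul (c ·P f) g ≗ c ·P psMul f g
psMul-·ˡ c f g n = trans (sumTo-cong (suc n) (λ k _ → ⊗-assoc c (f k) (g (n ∸ k))))
                          (sym (⊗-distribˡ-sumTo c _ (suc n)))

psMul-·ʳ : ∀ c f g → psMul f (c ·P g) ≗ c ·P psMul f g
psMul-·ʳ c f g n = trans (psMul-comm f (c ·P g) n)
                          (trans (psMul-·ˡ c g f n) (cong (c ⊗_) (psMul-comm g f n)))

psMul-assoc : ∀ f g h → psMul (psMul f g) h ≗ psMul f (psMul g h)
psMul-assoc f g h n = begin
  sumTo (λ k → psMul f g k ⊗ h (n ∸ k)) (suc n)
    ≡⟨ sumTo-cong (suc n) (λ k _ → ⊗-distribʳ-sumTo (h (n ∸ k)) _ (suc k)) ⟩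
  sumTo (λ k → sumTo (λ i → (f i ⊗ g (k ∸ i)) ⊗ h (n ∸ k)) (suc k)) (suc n)
    ≡⟨ sumTo-triangle (λ i k → (f i ⊗ g (k ∸ i)) ⊗ h (n ∸ k)) (suc n) ⟩
  sumTo (λ i → sumTo (λ j → (f i ⊗ g (i + j ∸ i)) ⊗ h (n ∸ (i + j))) (suc n ∸ i)) (suc n)
    ≡⟨ sumTo-cong (suc n) (λ i i<1+n → row i (≤-pred i<1+n)) ⟩
  sumTo (λ i → f i ⊗ psMul g h (n ∸ i)) (suc n)
    ∎
  where
  open ≡-Reasoning
  row : ∀ i → i ≤ n →
    sumTo (λ j → (f i ⊗ g (i + j ∸ i)) ⊗ h (n ∸ (i + j))) (suc n ∸ i) ≡ f i ⊗ psMul g h (n ∸ i)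
  row i i≤n = begin
    sumTo (λ j → (f i ⊗ g (i + j ∸ i)) ⊗ h (n ∸ (i + j))) (suc n ∸ i)
      ≡⟨ cong (sumTo _) (+-∸-assoc 1 i≤n) ⟩
    sumTo (λ j → (f i ⊗ g (i + j ∸ i)) ⊗ h (n ∸ (i + j))) (suc (n ∸ i))
      ≡⟨ sumTo-cong (suc (n ∸ i)) (λ j _ → trans
           (cong₂ (λ a b → (f i ⊗ g a) ⊗ h b) (m+n∸m≡n i j) (sym (∸-+-assoc n i j)))
           (⊗-assoc (f i) (g j) (h (n ∸ i ∸ j)))) ⟩
    sumTo (λ j → f i ⊗ (g j ⊗ h (n ∸ i ∸ j))) (suc (n ∸ i))
      ≡⟨ ⊗-distribˡ-sumTo (f i) _ (suc (n ∸ i)) ⟨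
    f i ⊗ psMul g h (n ∸ i)
      ∎

psMul-interchange : ∀ a b c d → psMul (psMul a b) (psMul c d) ≗ psMul (psMul a c) (psMul b d)
psMul-interchange a b c d n = begin
  psMul (psMul a b) (psMul c d) n  ≡⟨ psMul-assoc a b (psMul c d) n ⟩
  psMul a (psMul b (psMul c d)) n  ≡⟨ psMul-congʳ a inner n ⟩
  psMul a (psMul c (psMul b d)) n  ≡⟨ psMul-assoc a c (psMul b d) n ⟨
  psMul (psMul a c) (psMul b d) n  ∎
  where
  open ≡-Reasoning
  inner : psMul b (psMul c d) ≗ psMul c (psMul b d)
  inner m = trans (sym (psMul-assoc b c d m))
                  (trans (psMul-congˡ d (psMul-comm b c) m) (psMul-assoc c b d m))

psInv-stable : ∀ f n k → k ≤ n → invPre f n k ≡ psInv f k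
psInv-stable f zero    .zero z≤n = refl
psInv-stable f (suc n) k k≤1+n with m≤n⇒m<n∨m≡n k≤1+n
... | inj₂ refl = refl
... | inj₁ k<1+n = trans (if-T (≤⇒≤ᵇ (≤-pred k<1+n))) (psInv-stable f n k (≤-pred k<1+n))

psInv-suc : ∀ f n →
  psInv f (suc n) ≡ ⊖ (inv (f 0) ⊗ sumTo (λ m → f (suc m) ⊗ psInv f (n ∸ m)) (suc n))
psInv-suc f n = trans (if-¬T (<⇒≱ ≤-refl ∘ ≤ᵇ⇒≤ (suc n) n))
  (cong (λ s → ⊖ (inv (f 0) ⊗ s))
        (sumTo-cong (suc n) (λ m _ → cong (f (suc m) ⊗_) (psInv-stable f n (n ∸ m) (m∸n≤m n m)))))

psMul-inverseʳ : ∀ f → inv (f 0) ⊗ f 0 ≡ 1i → psMul f (psInv f) ≗ psOne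
psMul-inverseʳ f f₀⁻¹f₀≡1 zero    = trans (⊕-identityˡ _) (trans (⊗-comm (f 0) (inv (f 0))) f₀⁻¹f₀≡1)
psMul-inverseʳ f f₀⁻¹f₀≡1 (suc n) = begin
  psMul f (psInv f) (suc n)            ≡⟨ sumTo-sucˡ (λ k → f k ⊗ psInv f (suc n ∸ k)) (suc n) ⟩
  f 0 ⊗ psInv f (suc n) ⊕ S            ≡⟨ cong (λ x → f 0 ⊗ x ⊕ S) (psInv-suc f n) ⟩
  f 0 ⊗ ⊖ (inv (f 0) ⊗ S) ⊕ S          ≡⟨ regroup (f 0) (inv (f 0)) S ⟩
  ⊖ ((inv (f 0) ⊗ f 0) ⊗ S) ⊕ S        ≡⟨ cong (λ x → ⊖ (x ⊗ S) ⊕ S) f₀⁻¹f₀≡1 ⟩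
  ⊖ (1i ⊗ S) ⊕ S                       ≡⟨ cancel S ⟩
  0i                                   ∎
  where
  open ≡-Reasoning
  S = sumTo (λ m → f (suc m) ⊗ psInv f (n ∸ m)) (suc n)
  regroup : ∀ a b S → a ⊗ ⊖ (b ⊗ S) ⊕ S ≡ ⊖ ((b ⊗ a) ⊗ S) ⊕ S
  regroup = RingSolver.solve-∀ ℚi-ring
  cancel : ∀ S → ⊖ (1i ⊗ S) ⊕ S ≡ 0i
  cancel = RingSolver.solve-∀ ℚi-ring

psInv-unique : ∀ f g → inv (f 0) ⊗ f 0 ≡ 1i → psMul f g ≗ psOne → psInv f ≗ g
psInv-unique f g f₀⁻¹f₀≡1 fg≗1 n = begin
  psInv f n                          ≡⟨ psMul-identityʳ (psInv f) n ⟨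
  psMul (psInv f) psOne n            ≡⟨ psMul-congʳ (psInv f) (sym ∘ fg≗1) n ⟩
  psMul (psInv f) (psMul f g) n      ≡⟨ psMul-assoc (psInv f) f g n ⟨
  psMul (psMul (psInv f) f) g n      ≡⟨ psMul-congˡ g f⁻¹f≗1 n ⟩
  psMul psOne g n                    ≡⟨ psMul-identityˡ g n ⟩
  g n                                ∎
  where
  open ≡-Reasoning
  f⁻¹f≗1 : psMul (psInv f) f ≗ psOne
  f⁻¹f≗1 m = trans (psMul-comm (psInv f) f m) (psMul-inverseʳ f f₀⁻¹f₀≡1 m)

infix 4 _≡[_]_
_≡[_]_ : PS → ℕ → PS → Set
f ≡[ N ] g = ∀ k → k ≤ N → f k ≡ g k

≗⇒≡[] : ∀ {f g N} → f ≗ g → f ≡[ N ] g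
≗⇒≡[] f≗g k _ = f≗g k

≡[]-sym : ∀ {f g N} → f ≡[ N ] g → g ≡[ N ] f
≡[]-sym f≡g k k≤N = sym (f≡g k k≤N)

≡[]-trans : ∀ {f g h N} → f ≡[ N ] g → g ≡[ N ] h → f ≡[ N ] h
≡[]-trans f≡g g≡h k k≤N = trans (f≡g k k≤N) (g≡h k k≤N)

≡[]-weaken : ∀ {f g N M} → M ≤ N → f ≡[ N ] g → f ≡[ M ] g
≡[]-weaken M≤N f≡g k k≤M = f≡g k (≤-trans k≤M M≤N)

psMul-cong-≡[] : ∀ {N f f′ g g′} → f ≡[ N ] f′ → g ≡[ N ] g′ → psMul f g ≡[ N ] psMul f′ g′
psMul-cong-≡[] f≡f′ g≡g′ k k≤N = sumTo-cong (suc k) (λ i i<1+k →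
  cong₂ _⊗_ (f≡f′ i (≤-trans (≤-pred i<1+k) k≤N)) (g≡g′ (k ∸ i) (≤-trans (m∸n≤m k i) k≤N)))

psMul-≡[]-psOne : ∀ {N f g} → f ≡[ N ] psOne → g ≡[ N ] psOne → psMul f g ≡[ N ] psOne
psMul-≡[]-psOne f≡1 g≡1 = ≡[]-trans (psMul-cong-≡[] f≡1 g≡1) (≗⇒≡[] (psMul-identityʳ psOne))

1-t^ : ℕ → PS
1-t^ k = factorPS 1i k

1/[1-t^] : ℕ → PS
1/[1-t^] k = psInv (1-t^ k)

1-t^-inverseʳ : ∀ k → psMul (1-t^ (suc k)) (1/[1-t^] (suc k)) ≗ psOne
1-t^-inverseʳ k = psMul-inverseʳ (1-t^ (suc k)) refl

1-t^-≡[]-psOne : ∀ k → 1-t^ (suc k) ≡[ k ] psOne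
1-t^-≡[]-psOne k zero    _   = refl
1-t^-≡[]-psOne k (suc j) j<k =
  cong (0i ⊕_) (if-¬T (λ j≡k → <⇒≢ (s≤s j<k) (≡ᵇ⇒≡ (suc j) (suc k) j≡k)))

1/[1-t^]-≡[]-psOne : ∀ k → 1/[1-t^] (suc k) ≡[ k ] psOne
1/[1-t^]-≡[]-psOne k = ≡[]-trans (≡[]-sym inverse≡product) (≗⇒≡[] (1-t^-inverseʳ k))
  where
  inverse≡product : psMul (1-t^ (suc k)) (1/[1-t^] (suc k)) ≡[ k ] 1/[1-t^] (suc k)
  inverse≡product = ≡[]-trans (psMul-cong-≡[] {g = 1/[1-t^] (suc k)} (1-t^-≡[]-psOne k) (λ _ _ → refl))
                   (≗⇒≡[] (psMul-identityˡ (1/[1-t^] (suc k))))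

psPow : PS → ℕ → PS
psPow f zero    = psOne
psPow f (suc p) = psMul f (psPow f p)

psPow-≡[]-psOne : ∀ {f N} p → f ≡[ N ] psOne → psPow f p ≡[ N ] psOne
psPow-≡[]-psOne zero    f≡1 = λ _ _ → refl
psPow-≡[]-psOne (suc p) f≡1 = psMul-≡[]-psOne f≡1 (psPow-≡[]-psOne p f≡1)

psPow-+ : ∀ f p q → psPow f (p + q) ≗ psMul (psPow f p) (psPow f q)
psPow-+ f zero    q n = sym (psMul-identityˡ (psPow f q) n)
psPow-+ f (suc p) q n = trans (psMul-congʳ f (psPow-+ f p q) n)
                              (sym (psMul-assoc f (psPow f p) (psPow f q) n))

etaFactor : ℕ → ℕ → ℕ → PS
etaFactor k p m = psMul (psPow (1-t^ k) p) (psPow (1/[1-t^] k) m)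

etaFactor-≡[]-psOne : ∀ k p m → etaFactor (suc k) p m ≡[ k ] psOne
etaFactor-≡[]-psOne k p m =
  psMul-≡[]-psOne (psPow-≡[]-psOne p (1-t^-≡[]-psOne k)) (psPow-≡[]-psOne m (1/[1-t^]-≡[]-psOne k))

etaFactor-+ : ∀ k p m p′ m′ → etaFactor k (p + p′) (m + m′) ≗ psMul (etaFactor k p m) (etaFactor k p′ m′)
etaFactor-+ k p m p′ m′ n = trans
  (psMul-cong (psPow-+ (1-t^ k) p p′) (psPow-+ (1/[1-t^] k) m m′) n)
  (psMul-interchange (psPow (1-t^ k) p) (psPow (1-t^ k) p′) (psPow (1/[1-t^] k) m) (psPow (1/[1-t^] k) m′) n)

etaFactor-0-0 : ∀ k → etaFactor k 0 0 ≗ psOne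
etaFactor-0-0 k = psMul-identityʳ psOne

etaFactor-1-0 : ∀ k → etaFactor k 1 0 ≗ 1-t^ k
etaFactor-1-0 k n = trans (psMul-identityʳ (psMul (1-t^ k) psOne) n) (psMul-identityʳ (1-t^ k) n)

etaFactor-1-1 : ∀ k → etaFactor (suc k) 1 1 ≗ psOne
etaFactor-1-1 k n = begin
  etaFactor (suc k) 1 1 n
    ≡⟨ psMul-cong (psMul-identityʳ (1-t^ (suc k))) (psMul-identityʳ (1/[1-t^] (suc k))) n ⟩
  psMul (1-t^ (suc k)) (1/[1-t^] (suc k)) n
    ≡⟨ 1-t^-inverseʳ k n ⟩
  psOne n
    ∎
  where open ≡-Reasoning

etaFactor-cancel : ∀ k p m j → etaFactor (suc k) (p + j) (m + j) ≗ etaFactor (suc k) p m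
etaFactor-cancel k p m j n = begin
  etaFactor (suc k) (p + j) (m + j) n
    ≡⟨ etaFactor-+ (suc k) p m j j n ⟩
  psMul (etaFactor (suc k) p m) (etaFactor (suc k) j j) n
    ≡⟨ psMul-congʳ (etaFactor (suc k) p m) (balanced j) n ⟩
  psMul (etaFactor (suc k) p m) psOne n
    ≡⟨ psMul-identityʳ (etaFactor (suc k) p m) n ⟩
  etaFactor (suc k) p m n
    ∎
  where
  open ≡-Reasoning
  balanced : ∀ j → etaFactor (suc k) j j ≗ psOne
  balanced zero    = etaFactor-0-0 (suc k)
  balanced (suc j) n = begin
    etaFactor (suc k) (1 + j) (1 + j) n
      ≡⟨ etaFactor-+ (suc k) 1 1 j j n ⟩
    psMul (etaFactor (suc k) 1 1) (etaFactor (suc k) j j) n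
      ≡⟨ psMul-cong (etaFactor-1-1 k) (balanced j) n ⟩
    psMul psOne psOne n
      ≡⟨ psMul-identityʳ psOne n ⟩
    psOne n
      ∎

etaFactor-≡ : ∀ k p m p′ m′ → p + m′ ≡ p′ + m → etaFactor (suc k) p m ≗ etaFactor (suc k) p′ m′
etaFactor-≡ k p m p′ m′ p+m′≡p′+m n = begin
  etaFactor (suc k) p m n                  ≡⟨ etaFactor-cancel k p m m′ n ⟨
  etaFactor (suc k) (p + m′) (m + m′) n    ≡⟨ cong₂ (λ x y → etaFactor (suc k) x y n) p+m′≡p′+m (+-comm m m′) ⟩
  etaFactor (suc k) (p′ + m) (m′ + m) n    ≡⟨ etaFactor-cancel k p′ m′ m n ⟩
  etaFactor (suc k) p′ m′ n                ∎
  where open ≡-Reasoning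

-- The exponent of 1 - t^k is pos k - neg k.
record Exponents : Set where
  constructor exponents
  field
    pos neg : ℕ → ℕ
open Exponents

infixl 6 _+E_
_+E_ : Exponents → Exponents → Exponents
a +E b = exponents (λ k → pos a k + pos b k) (λ k → neg a k + neg b k)

-E_ : Exponents → Exponents
-E a = exponents (neg a) (pos a)

0E : Exponents
0E = exponents (λ _ → 0) (λ _ → 0)

-- equality of the eta quotients: the exponent at k = 0 never enters η
infix 4 _~_
_~_ : Exponents → Exponents → Set
a ~ b = ∀ k → pos a (suc k) + neg b (suc k) ≡ pos b (suc k) + neg a (suc k)

ηUpTo : Exponents → ℕ → PS
ηUpTo a zero    = psOne
ηUpTo a (suc N) = psMul (ηUpTo a N) (etaFactor (suc N) (pos a (suc N)) (neg a (suc N)))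

-- The factors with k > n do not affect the coefficient of t^n.
η : Exponents → PS
η a n = ηUpTo a n n

ηUpTo-extend : ∀ a N d → ηUpTo a (N + d) ≡[ N ] ηUpTo a N
ηUpTo-extend a N zero    k _ = cong (λ M → ηUpTo a M k) (+-identityʳ N)
ηUpTo-extend a N (suc d) = ≡[]-trans (λ k _ → cong (λ M → ηUpTo a M k) (+-suc N d))
  (≡[]-trans (≡[]-weaken (m≤m+n N d) last-factor) (ηUpTo-extend a N d))
  where
  last-factor : ηUpTo a (suc (N + d)) ≡[ N + d ] ηUpTo a (N + d)
  last-factor = ≡[]-trans
    (psMul-cong-≡[] {f = ηUpTo a (N + d)} (λ _ _ → refl)
                     (etaFactor-≡[]-psOne (N + d) (pos a (suc (N + d))) (neg a (suc (N + d)))))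
    (≗⇒≡[] (psMul-identityʳ (ηUpTo a (N + d))))

η-≡[]-ηUpTo : ∀ a N → η a ≡[ N ] ηUpTo a N
η-≡[]-ηUpTo a N k k≤N = begin
  ηUpTo a k k              ≡⟨ ηUpTo-extend a k (N ∸ k) k ≤-refl ⟨
  ηUpTo a (k + (N ∸ k)) k  ≡⟨ cong (λ M → ηUpTo a M k) (m+[n∸m]≡n k≤N) ⟩
  ηUpTo a N k              ∎
  where open ≡-Reasoning

ηUpTo-+E : ∀ a b N → ηUpTo (a +E b) N ≗ psMul (ηUpTo a N) (ηUpTo b N)
ηUpTo-+E a b zero    = λ n → sym (psMul-identityʳ psOne n)
ηUpTo-+E a b (suc N) n = trans
  (psMul-cong (ηUpTo-+E a b N) (etaFactor-+ (suc N) (pos a (suc N)) (neg a (suc N)) (pos b (suc N)) (neg b (suc N))) n)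
  (psMul-interchange (ηUpTo a N) (ηUpTo b N) (etaFactor (suc N) (pos a (suc N)) (neg a (suc N)))
                     (etaFactor (suc N) (pos b (suc N)) (neg b (suc N))) n)

η-+E : ∀ a b → η (a +E b) ≗ psMul (η a) (η b)
η-+E a b n = trans (ηUpTo-+E a b n n)
  (sym (psMul-cong-≡[] (η-≡[]-ηUpTo a n) (η-≡[]-ηUpTo b n) n ≤-refl))

η-~ : ∀ {a b} → a ~ b → η a ≗ η b
η-~ {a} {b} a~b n = ηUpTo-~ n n
  where
  ηUpTo-~ : ∀ N → ηUpTo a N ≗ ηUpTo b N
  ηUpTo-~ zero    = λ _ → refl
  ηUpTo-~ (suc N) = psMul-cong (ηUpTo-~ N)
    (etaFactor-≡ N (pos a (suc N)) (neg a (suc N)) (pos b (suc N)) (neg b (suc N)) (a~b N))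

η-0E : η 0E ≗ psOne
η-0E n = ηUpTo-0E n n
  where
  ηUpTo-0E : ∀ N → ηUpTo 0E N ≗ psOne
  ηUpTo-0E zero    = λ _ → refl
  ηUpTo-0E (suc N) m = trans (psMul-cong (ηUpTo-0E N) (etaFactor-0-0 (suc N)) m) (psMul-identityʳ psOne m)

η-inverseʳ : ∀ a → psMul (η a) (η (-E a)) ≗ psOne
η-inverseʳ a n = begin
  psMul (η a) (η (-E a)) n   ≡⟨ η-+E a (-E a) n ⟨
  η (a +E -E a) n            ≡⟨ η-~ a-a~0 n ⟩
  η 0E n                     ≡⟨ η-0E n ⟩
  psOne n                    ∎
  where
  open ≡-Reasoning
  a-a~0 : a +E -E a ~ 0E
  a-a~0 k = trans (+-identityʳ _) (+-comm (pos a (suc k)) (neg a (suc k)))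

η-quotient : ∀ X a b → psMul X (η b) ≗ η a → X ≗ η (a +E -E b)
η-quotient X a b Xηb≗ηa n = sym (begin
  η (a +E -E b) n                      ≡⟨ η-+E a (-E b) n ⟩
  psMul (η a) (η (-E b)) n             ≡⟨ psMul-congˡ (η (-E b)) Xηb≗ηa n ⟨
  psMul (psMul X (η b)) (η (-E b)) n   ≡⟨ psMul-assoc X (η b) (η (-E b)) n ⟩
  psMul X (psMul (η b) (η (-E b))) n   ≡⟨ psMul-congʳ X (η-inverseʳ b) n ⟩
  psMul X psOne n                      ≡⟨ psMul-identityʳ X n ⟩
  X n                                  ∎)
  where open ≡-Reasoning

ηUpTo-constant : ∀ a N j → (∀ i → i < j → pos a (N + suc i) ≡ 0 × neg a (N + suc i) ≡ 0) →
                 ηUpTo a (N + j) ≗ ηUpTo a N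
ηUpTo-constant a N zero    _      n = cong (λ M → ηUpTo a M n) (+-identityʳ N)
ηUpTo-constant a N (suc j) trivial n = begin
  ηUpTo a (N + suc j) n
    ≡⟨ cong (λ M → ηUpTo a M n) (+-suc N j) ⟩
  psMul (ηUpTo a (N + j)) (etaFactor (suc (N + j)) (pos a (suc (N + j))) (neg a (suc (N + j)))) n
    ≡⟨ psMul-congʳ (ηUpTo a (N + j)) trivial-factor n ⟩
  psMul (ηUpTo a (N + j)) psOne n
    ≡⟨ psMul-identityʳ (ηUpTo a (N + j)) n ⟩
  ηUpTo a (N + j) n
    ≡⟨ ηUpTo-constant a N j (λ i i<j → trivial i (m<n⇒m<1+n i<j)) n ⟩
  ηUpTo a N n
    ∎
  where
  open ≡-Reasoning
  trivial-factor : etaFactor (suc (N + j)) (pos a (suc (N + j))) (neg a (suc (N + j))) ≗ psOne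
  trivial-factor m rewrite sym (+-suc N j) | proj₁ (trivial j ≤-refl) | proj₂ (trivial j ≤-refl) =
    etaFactor-0-0 (N + suc j) m

η-finite : ∀ a N → (∀ i → pos a (N + suc i) ≡ 0 × neg a (N + suc i) ≡ 0) → η a ≗ ηUpTo a N
η-finite a N trivial n = trans (η-≡[]-ηUpTo a (N + n) n (m≤n+m n N))
                               (ηUpTo-constant a N n (λ i _ → trivial i) n)

iverson : {P : Set} → Dec P → ℕ
iverson (yes _) = 1
iverson (no _)  = 0

iverson-yes : ∀ {P : Set} (p? : Dec P) → P → iverson p? ≡ 1
iverson-yes (yes _) _ = refl
iverson-yes (no ¬p) p = ⊥-elim (¬p p)

iverson-no : ∀ {P : Set} (p? : Dec P) → ¬ P → iverson p? ≡ 0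
iverson-no (yes p) ¬p = ⊥-elim (¬p p)
iverson-no (no _)  _  = refl

iverson-⇔ : ∀ {P Q : Set} (p? : Dec P) (q? : Dec Q) → (P → Q) → (Q → P) → iverson p? ≡ iverson q?
iverson-⇔ (yes p) q? to from = sym (iverson-yes q? (to p))
iverson-⇔ (no ¬p) q? to from = sym (iverson-no q? (¬p ∘ from))

-- the exponents of Π_{j ≥ 0} (1 - t^(e + B j))
progression : ℕ → ℕ → Exponents
progression e B = exponents (λ k → iverson (e ≤? k ×-dec B ∣? k ∸ e)) (λ _ → 0)

progression-term : ∀ e B K → pos (progression e B) (e + B * K) ≡ 1
progression-term e B K = iverson-yes (e ≤? e + B * K ×-dec B ∣? e + B * K ∸ e)
  (m≤m+n e (B * K) , subst (B ∣_) (sym (m+n∸m≡n e (B * K))) (m∣m*n K))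

progression-gap : ∀ e B K i → 0 < i → i < B → pos (progression e B) (e + B * K + i) ≡ 0
progression-gap e B K i 0<i i<B =
  iverson-no (e ≤? e + B * K + i ×-dec B ∣? e + B * K + i ∸ e) (λ (_ , B∣k∸e) → <⇒≱ i<B (B≤i B∣k∸e))
  where
  k∸e≡ : e + B * K + i ∸ e ≡ B * K + i
  k∸e≡ = trans (cong (_∸ e) (+-assoc e (B * K) i)) (m+n∸m≡n e (B * K + i))
  B≤i : B ∣ e + B * K + i ∸ e → B ≤ i
  B≤i B∣k∸e = ∣⇒≤ {{ℕ.>-nonZero 0<i}} (∣m+n∣m⇒∣n (subst (B ∣_) k∸e≡ B∣k∸e) (m∣m*n K))

progression-below : ∀ e B k → k < e → pos (progression e B) k ≡ 0
progression-below e B k k<e = iverson-no (e ≤? k ×-dec B ∣? k ∸ e) (λ (e≤k , _) → <⇒≱ k<e e≤k)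

ηUpTo-progression : ∀ e b K →
  ηUpTo (progression (suc e) (suc b)) (e + suc b * K) ≗ finProd 1i (suc e) (suc b) K
ηUpTo-progression e b zero n = begin
  ηUpTo a (e + suc b * 0) n
    ≡⟨ cong (λ M → ηUpTo a M n) (trans (+-comm e _) (cong (_+ e) (*-zeroʳ b))) ⟩
  ηUpTo a (0 + e) n
    ≡⟨ ηUpTo-constant a 0 e (λ i i<e → progression-below (suc e) (suc b) (suc i) (s≤s i<e) , refl) n ⟩
  psOne n
    ∎
  where
  open ≡-Reasoning
  a = progression (suc e) (suc b)
ηUpTo-progression e b (suc K) n = begin
  ηUpTo a (e + suc b * suc K) n
    ≡⟨ cong (λ M → ηUpTo a M n) (next-term e b K) ⟩
  ηUpTo a (suc M + b) n
    ≡⟨ ηUpTo-constant a (suc M) b gap n ⟩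
  psMul (ηUpTo a M) (etaFactor (suc M) (pos a (suc M)) 0) n
    ≡⟨ psMul-cong (ηUpTo-progression e b K) (λ m → cong (λ p → etaFactor (suc M) p 0 m) term) n ⟩
  psMul (finProd 1i (suc e) (suc b) K) (etaFactor (suc M) 1 0) n
    ≡⟨ psMul-congʳ (finProd 1i (suc e) (suc b) K) (etaFactor-1-0 (suc M)) n ⟩
  finProd 1i (suc e) (suc b) (suc K) n
    ∎
  where
  open ≡-Reasoning
  a = progression (suc e) (suc b)
  M = e + suc b * K
  gap : ∀ i → i < b → pos a (suc M + suc i) ≡ 0 × neg a (suc M + suc i) ≡ 0
  gap i i<b = progression-gap (suc e) (suc b) K (suc i) (s≤s z≤n) (s≤s i<b) , refl
  term : pos a (suc M) ≡ 1
  term = progression-term (suc e) (suc b) K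
  next-term : ∀ e b K → e + suc b * suc K ≡ suc (e + suc b * K) + b
  next-term = solve-∀

η-≡[]-finProd : ∀ e b n → η (progression (suc e) (suc b)) ≡[ n ] finProd 1i (suc e) (suc b) (suc n)
η-≡[]-finProd e b n = ≡[]-trans (≡[]-weaken n≤ (η-≡[]-ηUpTo _ (e + suc b * suc n)))
                                (≗⇒≡[] (ηUpTo-progression e b (suc n)))
  where
  n≤ : n ≤ e + suc b * suc n
  n≤ = ≤-trans (n≤1+n n) (≤-trans (m≤m+n (suc n) (b * suc n)) (m≤n+m _ e))

tailPS-progression : ∀ e b → tailPS 1i (suc e) (suc b) ≗ η (progression (suc e) (suc b))
tailPS-progression e b n = sym (η-≡[]-finProd e b n n ≤-refl)

single : ℕ → Exponents
single m = exponents (λ k → iverson (k ≟ m)) (λ _ → 0)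

η-single : ∀ m → η (single (suc m)) ≗ 1-t^ (suc m)
η-single m n = begin
  η a n
    ≡⟨ η-finite a (suc m) (λ i → iverson-no (suc m + suc i ≟ suc m) (m+1+n≢m (suc m)) , refl) n ⟩
  psMul (ηUpTo a m) (etaFactor (suc m) (iverson (suc m ≟ suc m)) 0) n
    ≡⟨ cong (λ e → psMul (ηUpTo a m) (etaFactor (suc m) e 0) n) (iverson-yes (suc m ≟ suc m) refl) ⟩
  psMul (ηUpTo a m) (etaFactor (suc m) 1 0) n
    ≡⟨ psMul-cong below (etaFactor-1-0 (suc m)) n ⟩
  psMul psOne (1-t^ (suc m)) n
    ≡⟨ psMul-identityˡ (1-t^ (suc m)) n ⟩
  1-t^ (suc m) n
    ∎
  where
  open ≡-Reasoning
  a = single (suc m)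
  below : ηUpTo a m ≗ psOne
  below = ηUpTo-constant a 0 m (λ i i<m → iverson-no (suc i ≟ suc m) (<⇒≢ (s≤s i<m)) , refl)

psMul-factorPS : ∀ c d g n →
  psMul (factorPS c (suc d)) g n ≡ g n ⊕ (if suc d ≤ᵇ n then ⊖ c ⊗ g (n ∸ suc d) else 0i)
psMul-factorPS c d g n = begin
  sumTo (λ k → (psOne k ⊕ -ctᵈ k) ⊗ g (n ∸ k)) (suc n)
    ≡⟨ sumTo-cong (suc n) (λ k _ → ⊗-distribʳ-⊕ (g (n ∸ k)) (psOne k) (-ctᵈ k)) ⟩
  sumTo (λ k → psOne k ⊗ g (n ∸ k) ⊕ -ctᵈ k ⊗ g (n ∸ k)) (suc n)
    ≡⟨ sumTo-⊕ (λ k → psOne k ⊗ g (n ∸ k)) (λ k → -ctᵈ k ⊗ g (n ∸ k)) (suc n) ⟩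
  sumTo (λ k → psOne k ⊗ g (n ∸ k)) (suc n) ⊕ sumTo (λ k → -ctᵈ k ⊗ g (n ∸ k)) (suc n)
    ≡⟨ cong₂ _⊕_ constant-part shifted-part ⟩
  g n ⊕ (if suc d ≤ᵇ n then ⊖ c ⊗ g (n ∸ suc d) else 0i)
    ∎
  where
  open ≡-Reasoning
  -ctᵈ : ℕ → ℚi
  -ctᵈ k = if k ≡ᵇ suc d then ⊖ c else 0i
  -ctᵈ-off : ∀ k → k ≢ suc d → -ctᵈ k ⊗ g (n ∸ k) ≡ 0i
  -ctᵈ-off k k≢d = trans (cong (_⊗ g (n ∸ k)) (if-¬T (k≢d ∘ ≡ᵇ⇒≡ k (suc d)))) (⊗-zeroˡ (g (n ∸ k)))
  constant-part : sumTo (λ k → psOne k ⊗ g (n ∸ k)) (suc n) ≡ g n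
  constant-part = trans (sumTo-single _ (suc n) 0 (s≤s z≤n) λ { zero _ 0≢0 → ⊥-elim (0≢0 refl)
                                                              ; (suc k) _ _ → ⊗-zeroˡ (g (n ∸ suc k)) })
                        (⊗-identityˡ (g n))
  shifted-part : sumTo (λ k → -ctᵈ k ⊗ g (n ∸ k)) (suc n) ≡ (if suc d ≤ᵇ n then ⊖ c ⊗ g (n ∸ suc d) else 0i)
  shifted-part with suc d ≤? n
  ... | yes d<n = trans (sumTo-single _ (suc n) (suc d) (s≤s d<n) (λ k _ → -ctᵈ-off k))
                        (trans (cong (_⊗ g (n ∸ suc d)) (if-T (≡⇒≡ᵇ (suc d) (suc d) refl)))
                               (sym (if-T (≤⇒≤ᵇ d<n))))
  ... | no d≮n  = trans (sumTo-zero _ (suc n) (λ k k<1+n → -ctᵈ-off k (λ k≡d → d≮n (subst (_≤ n) k≡d (≤-pred k<1+n)))))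
                        (sym (if-¬T (d≮n ∘ ≤ᵇ⇒≤ (suc d) n)))

1-t^-below : ∀ D n → n < D → 1-t^ D n ≡ psOne n ⊕ 0i
1-t^-below D n n<D = cong (psOne n ⊕_) (if-¬T (λ n≡D → <⇒≢ n<D (≡ᵇ⇒≡ n D n≡D)))

1+t^-difference-of-squares : ∀ d → psMul (factorPS (⊖ 1i) (suc d)) (1-t^ (suc d)) ≗ 1-t^ (suc d + suc d)
1+t^-difference-of-squares d n = trans (psMul-factorPS (⊖ 1i) d (1-t^ D) n) (by-degree n)
  where
  D = suc d
  above : ∀ m → 1-t^ D (D + m) ⊕ ⊖ (⊖ 1i) ⊗ 1-t^ D m ≡ 1-t^ (D + D) (D + m)
  above zero rewrite +-identityʳ d | ≡ᵇ-refl d | ≢⇒≡ᵇ-false (<⇒≢ (m<m+n d {D} (s≤s z≤n))) = refl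
  above (suc m) rewrite ≡ᵇ-+ˡ d (suc m) D | ≢⇒≡ᵇ-false (<⇒≢ (m<m+n d {suc m} (s≤s z≤n)) ∘ sym)
    with suc m ≡ᵇ D
  ... | true  = refl
  ... | false = refl
  by-degree : ∀ n → 1-t^ D n ⊕ (if D ≤ᵇ n then ⊖ (⊖ 1i) ⊗ 1-t^ D (n ∸ D) else 0i) ≡ 1-t^ (D + D) n
  by-degree n with D ≤? n
  ... | yes D≤n = begin
    1-t^ D n ⊕ (if D ≤ᵇ n then ⊖ (⊖ 1i) ⊗ 1-t^ D (n ∸ D) else 0i)
      ≡⟨ cong (1-t^ D n ⊕_) (if-T (≤⇒≤ᵇ D≤n)) ⟩
    1-t^ D n ⊕ ⊖ (⊖ 1i) ⊗ 1-t^ D (n ∸ D)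
      ≡⟨ cong (λ k → 1-t^ D k ⊕ ⊖ (⊖ 1i) ⊗ 1-t^ D (k ∸ D)) (m+[n∸m]≡n D≤n) ⟨
    1-t^ D (D + (n ∸ D)) ⊕ ⊖ (⊖ 1i) ⊗ 1-t^ D (D + (n ∸ D) ∸ D)
      ≡⟨ cong (λ k → 1-t^ D (D + (n ∸ D)) ⊕ ⊖ (⊖ 1i) ⊗ 1-t^ D k) (m+n∸m≡n D (n ∸ D)) ⟩
    1-t^ D (D + (n ∸ D)) ⊕ ⊖ (⊖ 1i) ⊗ 1-t^ D (n ∸ D)
      ≡⟨ above (n ∸ D) ⟩
    1-t^ (D + D) (D + (n ∸ D))
      ≡⟨ cong (1-t^ (D + D)) (m+[n∸m]≡n D≤n) ⟩
    1-t^ (D + D) n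
      ∎
    where open ≡-Reasoning
  ... | no D≰n = begin
    1-t^ D n ⊕ (if D ≤ᵇ n then ⊖ (⊖ 1i) ⊗ 1-t^ D (n ∸ D) else 0i)
      ≡⟨ cong (1-t^ D n ⊕_) (if-¬T (D≰n ∘ ≤ᵇ⇒≤ D n)) ⟩
    1-t^ D n ⊕ 0i           ≡⟨ ⊕-identityʳ _ ⟩
    1-t^ D n                ≡⟨ 1-t^-below D n n<D ⟩
    psOne n ⊕ 0i            ≡⟨ 1-t^-below (D + D) n (≤-trans n<D (m≤m+n D D)) ⟨
    1-t^ (D + D) n          ∎
    where
    open ≡-Reasoning
    n<D = ≰⇒> D≰n

finProd-difference-of-squares : ∀ e B K →
  psMul (finProd (⊖ 1i) (suc e) B K) (finProd 1i (suc e) B K) ≗ finProd 1i (suc e + suc e) (B + B) K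
finProd-difference-of-squares e B zero    = psMul-identityʳ psOne
finProd-difference-of-squares e B (suc K) n = begin
  psMul (psMul X⁺ (factorPS (⊖ 1i) (suc e + B * K))) (psMul X⁻ (1-t^ (suc e + B * K))) n
    ≡⟨ psMul-interchange X⁺ (factorPS (⊖ 1i) (suc e + B * K)) X⁻ (1-t^ (suc e + B * K)) n ⟩
  psMul (psMul X⁺ X⁻) (psMul (factorPS (⊖ 1i) (suc e + B * K)) (1-t^ (suc e + B * K))) n
    ≡⟨ psMul-cong (finProd-difference-of-squares e B K) (1+t^-difference-of-squares (e + B * K)) n ⟩
  psMul (finProd 1i (suc e + suc e) (B + B) K) (1-t^ (suc (e + B * K) + suc (e + B * K))) n
    ≡⟨ cong (λ k → psMul (finProd 1i (suc e + suc e) (B + B) K) (1-t^ k) n) (double-term e B K) ⟨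
  finProd 1i (suc e + suc e) (B + B) (suc K) n
    ∎
  where
  open ≡-Reasoning
  X⁺ = finProd (⊖ 1i) (suc e) B K
  X⁻ = finProd 1i (suc e) B K
  double-term : ∀ e B K → (suc e + suc e) + (B + B) * K ≡ suc (e + B * K) + suc (e + B * K)
  double-term = solve-∀

tailPS-negated-progression : ∀ e b → tailPS (⊖ 1i) (suc e) (suc b) ≗
  η (progression (suc e + suc e) (suc b + suc b) +E -E progression (suc e) (suc b))
tailPS-negated-progression e b n = sym (begin
  η (a₂ +E -E a₁) n                          ≡⟨ η-+E a₂ (-E a₁) n ⟩
  psMul (η a₂) (η (-E a₁)) n                 ≡⟨ psMul-cong-≡[] {g = η (-E a₁)} η≡Z (λ _ _ → refl) n ≤-refl ⟩
  psMul Z (η (-E a₁)) n                      ≡⟨ psMul-congˡ (η (-E a₁)) XY≗Z n ⟨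
  psMul (psMul X Y) (η (-E a₁)) n            ≡⟨ psMul-assoc X Y (η (-E a₁)) n ⟩
  psMul X (psMul Y (η (-E a₁))) n            ≡⟨ psMul-cong-≡[] {f = X} (λ _ _ → refl) Y≡η n ≤-refl ⟩
  psMul X (psMul (η a₁) (η (-E a₁))) n       ≡⟨ psMul-congʳ X (η-inverseʳ a₁) n ⟩
  psMul X psOne n                            ≡⟨ psMul-identityʳ X n ⟩
  X n                                        ∎)
  where
  open ≡-Reasoning
  a₁ = progression (suc e) (suc b)
  a₂ = progression (suc e + suc e) (suc b + suc b)
  X = finProd (⊖ 1i) (suc e) (suc b) (suc n)
  Y = finProd 1i (suc e) (suc b) (suc n)
  Z = finProd 1i (suc e + suc e) (suc b + suc b) (suc n)
  η≡Z : η a₂ ≡[ n ] Z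
  η≡Z = η-≡[]-finProd (e + suc e) (b + suc b) n
  XY≗Z : psMul X Y ≗ Z
  XY≗Z = finProd-difference-of-squares e (suc b) (suc n)
  Y≡η : psMul Y (η (-E a₁)) ≡[ n ] psMul (η a₁) (η (-E a₁))
  Y≡η = psMul-cong-≡[] {g = η (-E a₁)} (≡[]-sym (η-≡[]-finProd e b n)) (λ _ _ → refl)

coeffAt-below : ∀ L e m n → m ℤ.≤ sh L → e ℤ.- m ≡ -[1+ n ] → coeffAt L e ≡ 0i
coeffAt-below L e m n m≤s e-m≡-[1+n] with e ℤ.- sh L in e-s≡
... | -[1+ _ ] = refl
... | + k      = ⊥-elim (nonnegative (subst (0ℤ ℤ.≤_) e-m≡-[1+n] 0≤e-m))
  where
  nonnegative : ¬ (0ℤ ℤ.≤ -[1+ n ])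
  nonnegative ()
  0≤e-m : 0ℤ ℤ.≤ e ℤ.- m
  0≤e-m = subst (0ℤ ℤ.≤_) (ℤP.+-minus-telescope e (sh L) m)
            (ℤP.+-mono-≤ (subst (0ℤ ℤ.≤_) (sym e-s≡) (ℤ.+≤+ z≤n)) (ℤP.i≤j⇒0≤j-i m≤s))

coeffAt-+L : ∀ A B e → coeffAt (A +L B) e ≡ coeffAt A e ⊕ coeffAt B e
coeffAt-+L A B e with e ℤ.- (sh A ℤ.⊓ sh B) in e-m≡
... | + n      = cong (λ x → coeffAt A x ⊕ coeffAt B x)
                      (trans (cong (λ x → (sh A ℤ.⊓ sh B) ℤ.+ x) (sym e-m≡)) (m+[e-m]≡e (sh A ℤ.⊓ sh B) e))
  where
  m+[e-m]≡e : ∀ m e → m ℤ.+ (e ℤ.- m) ≡ e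
  m+[e-m]≡e = ℤ-Solver.solve-∀
... | -[1+ n ] = sym (trans (cong₂ _⊕_ (coeffAt-below A e _ n (ℤP.i⊓j≤i (sh A) (sh B)) e-m≡)
                                       (coeffAt-below B e _ n (ℤP.i⊓j≤j (sh A) (sh B)) e-m≡))
                            (⊕-identityʳ 0i))

Periodic : ℕ → ℕ → Exponents → Set
Periodic N p a = ∀ k → N ≤ k → pos a (k + p) ≡ pos a k × neg a (k + p) ≡ neg a k

Periodic-+E : ∀ {N p a b} → Periodic N p a → Periodic N p b → Periodic N p (a +E b)
Periodic-+E per-a per-b k N≤k =
    cong₂ _+_ (proj₁ (per-a k N≤k)) (proj₁ (per-b k N≤k))
  , cong₂ _+_ (proj₂ (per-a k N≤k)) (proj₂ (per-b k N≤k))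

Periodic-negE : ∀ {N p a} → Periodic N p a → Periodic N p (-E a)
Periodic-negE per-a k N≤k = proj₂ (per-a k N≤k) , proj₁ (per-a k N≤k)

Periodic-0E : ∀ {N p} → Periodic N p 0E
Periodic-0E k _ = refl , refl

Periodic-progression : ∀ {N p} e B → e ≤ N → B ∣ p → Periodic N p (progression e B)
Periodic-progression {N} {p} e B e≤N B∣p k N≤k = iverson-⇔ _ _ shift-back shift-forward , refl
  where
  e≤k = ≤-trans e≤N N≤k
  k+p∸e≡ : k + p ∸ e ≡ k ∸ e + p
  k+p∸e≡ = +-∸-comm p e≤k
  shift-back : e ≤ k + p × B ∣ k + p ∸ e → e ≤ k × B ∣ k ∸ e
  shift-back (_ , B∣) = e≤k , ∣m+n∣m⇒∣n (subst (B ∣_) (trans k+p∸e≡ (+-comm (k ∸ e) p)) B∣) B∣p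
  shift-forward : e ≤ k × B ∣ k ∸ e → e ≤ k + p × B ∣ k + p ∸ e
  shift-forward (_ , B∣) = ≤-trans e≤k (m≤m+n k p) , subst (B ∣_) (sym k+p∸e≡) (∣m∣n⇒∣m+n B∣ B∣p)

Periodic-single : ∀ {N p} m → m < N → Periodic N p (single m)
Periodic-single {N} {p} m m<N k N≤k =
  trans (iverson-no (k + p ≟ m) (λ k+p≡m → <⇒≱ m<N (≤-trans N≤k (subst (k ≤_) k+p≡m (m≤m+n k p)))))
        (sym (iverson-no (k ≟ m) (λ k≡m → <⇒≱ m<N (subst (N ≤_) k≡m N≤k))))
  , refl

agreeUpTo : Exponents → Exponents → ℕ → Bool
agreeUpTo a b zero    = true
agreeUpTo a b (suc n) = (pos a n + neg b n ≡ᵇ pos b n + neg a n) ∧ agreeUpTo a b n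

agreeUpTo-sound : ∀ a b n → T (agreeUpTo a b n) → ∀ k → k < n → pos a k + neg b k ≡ pos b k + neg a k
agreeUpTo-sound a b (suc n) agree k k<1+n with Equivalence.to T-∧ agree | m≤n⇒m<n∨m≡n (≤-pred k<1+n)
... | agree-n , _     | inj₂ refl = ≡ᵇ⇒≡ _ _ agree-n
... | _ , agree-below | inj₁ k<n  = agreeUpTo-sound a b n agree-below k k<n

~-byAgreement : ∀ {N p a b} → 0 < p → Periodic N p a → Periodic N p b → T (agreeUpTo a b (N + p)) → a ~ b
~-byAgreement {N} {p} {a} {b} 0<p per-a per-b agree k = <-rec Agree agree-at (suc k)
  where
  Agree : ℕ → Set
  Agree m = pos a m + neg b m ≡ pos b m + neg a m
  agree-at : ∀ m → (∀ {j} → j < m → Agree j) → Agree m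
  agree-at m below with m <? N + p
  ... | yes m<N+p = agreeUpTo-sound a b (N + p) agree m m<N+p
  ... | no  m≮N+p = subst Agree j+p≡m (begin
      pos a (j + p) + neg b (j + p)  ≡⟨ cong₂ _+_ (proj₁ (per-a j N≤j)) (proj₂ (per-b j N≤j)) ⟩
      pos a j + neg b j              ≡⟨ below j<m ⟩
      pos b j + neg a j              ≡⟨ cong₂ _+_ (proj₁ (per-b j N≤j)) (proj₂ (per-a j N≤j)) ⟨
      pos b (j + p) + neg a (j + p)  ∎)
    where
    open ≡-Reasoning
    j = m ∸ p
    N+p≤m = ≮⇒≥ m≮N+p
    N≤j : N ≤ j
    N≤j = subst (_≤ m ∸ p) (m+n∸n≡m N p) (∸-monoˡ-≤ p N+p≤m)
    j+p≡m : j + p ≡ m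
    j+p≡m = m∸n+n≡m (≤-trans (m≤n+m p N) N+p≤m)
    j<m : j < m
    j<m = subst (j <_) j+p≡m (m<m+n j 0<p)

module EtaForms (N p : ℕ) {{_ : ℕ.NonZero p}} where

  record EtaForm (A : LS) (c : ℚi) (s : ℤ) (a : Exponents) : Set where
    constructor etaForm
    field
      shift    : sh A ≡ s
      coeffs   : co A ≗ c ·P η a
      periodic : Periodic N p a

  EtaForm-coef : ∀ {A c c′ s a} → EtaForm A c s a → c ≡ c′ → EtaForm A c′ s a
  EtaForm-coef A-form refl = A-form

  EtaForm-*L : ∀ {A B c d s u a b} → EtaForm A c s a → EtaForm B d u b → EtaForm (A *L B) (c ⊗ d) (s ℤ.+ u) (a +E b)
  EtaForm-*L {A} {B} {c} {d} {s} {u} {a} {b} (etaForm refl A≗ per-a) (etaForm refl B≗ per-b) =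
    etaForm refl AB≗ (Periodic-+E per-a per-b)
    where
    open ≡-Reasoning
    regroup : ∀ c d x → c ⊗ (d ⊗ x) ≡ (c ⊗ d) ⊗ x
    regroup = RingSolver.solve-∀ ℚi-ring
    AB≗ : psMul (co A) (co B) ≗ (c ⊗ d) ·P η (a +E b)
    AB≗ n = begin
      psMul (co A) (co B) n               ≡⟨ psMul-cong A≗ B≗ n ⟩
      psMul (c ·P η a) (d ·P η b) n       ≡⟨ psMul-·ˡ c (η a) (d ·P η b) n ⟩
      c ⊗ psMul (η a) (d ·P η b) n        ≡⟨ cong (c ⊗_) (psMul-·ʳ d (η a) (η b) n) ⟩
      c ⊗ (d ⊗ psMul (η a) (η b) n)       ≡⟨ regroup c d _ ⟩
      (c ⊗ d) ⊗ psMul (η a) (η b) n       ≡⟨ cong ((c ⊗ d) ⊗_) (η-+E a b n) ⟨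
      (c ⊗ d) ⊗ η (a +E b) n              ∎

  EtaForm-invL : ∀ {A c s a} → EtaForm A c s a → inv c ⊗ c ≡ 1i → EtaForm (invL A) (inv c) (ℤ.- s) (-E a)
  EtaForm-invL {A} {c} {s} {a} (etaForm refl A≗ per-a) c⁻¹c≡1 =
    etaForm refl (psInv-unique (co A) (inv c ·P η (-E a)) A₀⁻¹A₀≡1 A⁻¹-inverse) (Periodic-negE per-a)
    where
    open ≡-Reasoning
    A₀≡c : co A 0 ≡ c
    A₀≡c = trans (A≗ 0) (⊗-identityʳ c)
    A₀⁻¹A₀≡1 : inv (co A 0) ⊗ co A 0 ≡ 1i
    A₀⁻¹A₀≡1 = trans (cong (λ x → inv x ⊗ x) A₀≡c) c⁻¹c≡1
    regroup : ∀ c d x → c ⊗ (d ⊗ x) ≡ (d ⊗ c) ⊗ x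
    regroup = RingSolver.solve-∀ ℚi-ring
    A⁻¹-inverse : psMul (co A) (inv c ·P η (-E a)) ≗ psOne
    A⁻¹-inverse n = begin
      psMul (co A) (inv c ·P η (-E a)) n          ≡⟨ psMul-congˡ (inv c ·P η (-E a)) A≗ n ⟩
      psMul (c ·P η a) (inv c ·P η (-E a)) n      ≡⟨ psMul-·ˡ c (η a) (inv c ·P η (-E a)) n ⟩
      c ⊗ psMul (η a) (inv c ·P η (-E a)) n       ≡⟨ cong (c ⊗_) (psMul-·ʳ (inv c) (η a) (η (-E a)) n) ⟩
      c ⊗ (inv c ⊗ psMul (η a) (η (-E a)) n)      ≡⟨ regroup c (inv c) _ ⟩
      (inv c ⊗ c) ⊗ psMul (η a) (η (-E a)) n      ≡⟨ cong₂ _⊗_ c⁻¹c≡1 (η-inverseʳ a n) ⟩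
      1i ⊗ psOne n                                ≡⟨ ⊗-identityˡ (psOne n) ⟩
      psOne n                                     ∎

  infixl 7 _⋆_ _⊘_

  -- The right factor is required to have constant 1i: type checking the closed forms below
  -- evaluates their constants, and unnormalised products of ℚi constants are exponentially costly.
  _⋆_ : ∀ {A B c s u a b} → EtaForm A c s a → EtaForm B 1i u b → EtaForm (A *L B) c (s ℤ.+ u) (a +E b)
  A-form ⋆ B-form = EtaForm-coef (EtaForm-*L A-form B-form) (⊗-identityʳ _)

  _⊘_ : ∀ {A B c s u a b} → EtaForm A c s a → EtaForm B 1i u b → EtaForm (A /L B) c (s ℤ.+ ℤ.- u) (a +E -E b)
  A-form ⊘ B-form = EtaForm-coef (EtaForm-*L A-form (EtaForm-invL B-form refl)) (⊗-identityʳ _)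

  EtaForm-jf : ∀ x b {c s₁ s₂ s₃ a₁ a₂ a₃} → EtaForm (poch x b) c s₁ a₁ →
               EtaForm (poch (qp (+ b) ⊛ monoInv x) b) 1i s₂ a₂ → EtaForm (poch (qp (+ b)) b) 1i s₃ a₃ →
               EtaForm (jf x b) c (s₁ ℤ.+ s₂ ℤ.+ s₃) (a₁ +E a₂ +E a₃)
  EtaForm-jf x b x-form b/x-form b-form = x-form ⋆ b/x-form ⋆ b-form

  EtaForm-·L : ∀ {A c s a} d → EtaForm A c s a → EtaForm (d ·L A) (d ⊗ c) s a
  EtaForm-·L {A} {c} {s} {a} d (etaForm refl A≗ per-a) =
    etaForm refl (λ n → trans (cong (d ⊗_) (A≗ n)) (sym (⊗-assoc d c (η a n)))) per-a

  EtaForm-monoL : ∀ m → EtaForm (monoL m) (coef m) (texp m) 0E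
  EtaForm-monoL (mono c e) = etaForm refl c≗ (Periodic-0E {N} {p})
    where
    c≗ : co (monoL (mono c e)) ≗ c ·P η 0E
    c≗ n = trans (c·psOne n) (cong (c ⊗_) (sym (η-0E n)))
      where
      c·psOne : ∀ n → co (monoL (mono c e)) n ≡ c ⊗ psOne n
      c·psOne zero    = sym (⊗-identityʳ c)
      c·psOne (suc n) = sym (⊗-zeroʳ c)

  EtaForm-oneL : EtaForm oneL 1i (+ 0) 0E
  EtaForm-oneL = EtaForm-monoL (mono 1i (+ 0))

  EtaForm-ℚL : ∀ q → EtaForm (ℚL q) (fromℚ q) (+ 0) 0E
  EtaForm-ℚL q = EtaForm-monoL (mono (fromℚ q) (+ 0))

  coeffAt-EtaForm : ∀ {A c s a} → EtaForm A c s a → ∀ e → coeffAt A e ≡ c ⊗ coeffAt (ls s (η a)) e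
  coeffAt-EtaForm {ls s f} {c} (etaForm refl f≗ _) e with e ℤ.- s
  ... | + n      = f≗ n
  ... | -[1+ n ] = sym (⊗-zeroʳ c)

  coeffAt-η-agree : ∀ {a b} s → Periodic N p a → Periodic N p b → T (agreeUpTo a b (N + p)) →
                    ∀ e → coeffAt (ls s (η a)) e ≡ coeffAt (ls s (η b)) e
  coeffAt-η-agree s per-a per-b agree e with e ℤ.- s
  ... | + n      = η-~ (~-byAgreement (ℕ.>-nonZero⁻¹ p) per-a per-b agree) n
  ... | -[1+ n ] = refl

  EtaForm-≈L : ∀ {A B c s a b} → EtaForm A c s a → EtaForm B c s b → T (agreeUpTo a b (N + p)) → A ≈L B
  EtaForm-≈L {A} {B} {c} {s} {a} {b} A-form B-form agree e = begin
    coeffAt A e                  ≡⟨ coeffAt-EtaForm A-form e ⟩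
    c ⊗ coeffAt (ls s (η a)) e   ≡⟨ cong (c ⊗_) (coeffAt-η-agree s (periodic A-form) (periodic B-form) agree e) ⟩
    c ⊗ coeffAt (ls s (η b)) e   ≡⟨ coeffAt-EtaForm B-form e ⟨
    coeffAt B e                  ∎
    where
    open ≡-Reasoning
    open EtaForm

  EtaForm-+L-≈L : ∀ {A B R c d s a b r} → EtaForm A c s a → EtaForm B d s b → EtaForm R (c ⊕ d) s r →
                  T (agreeUpTo b a (N + p)) → T (agreeUpTo r a (N + p)) → A +L B ≈L R
  EtaForm-+L-≈L {A} {B} {R} {c} {d} {s} {a} {b} {r} A-form B-form R-form agree-b agree-r e = begin
    coeffAt (A +L B) e
      ≡⟨ coeffAt-+L A B e ⟩
    coeffAt A e ⊕ coeffAt B e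
      ≡⟨ cong₂ _⊕_ (coeffAt-EtaForm A-form e) (coeffAt-EtaForm B-form e) ⟩
    c ⊗ ηₐ ⊕ d ⊗ coeffAt (ls s (η b)) e
      ≡⟨ cong (λ x → c ⊗ ηₐ ⊕ d ⊗ x) (coeffAt-η-agree s (periodic B-form) (periodic A-form) agree-b e) ⟩
    c ⊗ ηₐ ⊕ d ⊗ ηₐ
      ≡⟨ ⊗-distribʳ-⊕ ηₐ c d ⟨
    (c ⊕ d) ⊗ ηₐ
      ≡⟨ cong ((c ⊕ d) ⊗_) (coeffAt-η-agree s (periodic R-form) (periodic A-form) agree-r e) ⟨
    (c ⊕ d) ⊗ coeffAt (ls s (η r)) e
      ≡⟨ coeffAt-EtaForm R-form e ⟨
    coeffAt R e
      ∎
    where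
    open ≡-Reasoning
    open EtaForm
    ηₐ = coeffAt (ls s (η a)) e

  first-cancels-third : ∀ {T₁ T₂ T₃ R c s a b} → EtaForm T₁ c s a → EtaForm T₃ (⊖ c) s b →
                        T (agreeUpTo b a (N + p)) → T₂ ≈L R → (T₁ +L T₂) +L T₃ ≈L R
  first-cancels-third {T₁} {T₂} {T₃} {R} {c} {s} {a} {b} T₁-form T₃-form agree T₂≈R e = begin
    coeffAt ((T₁ +L T₂) +L T₃) e
      ≡⟨ coeffAt-+L (T₁ +L T₂) T₃ e ⟩
    coeffAt (T₁ +L T₂) e ⊕ coeffAt T₃ e
      ≡⟨ cong (_⊕ coeffAt T₃ e) (coeffAt-+L T₁ T₂ e) ⟩
    (coeffAt T₁ e ⊕ coeffAt T₂ e) ⊕ coeffAt T₃ e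
      ≡⟨ cong₂ (λ x y → (x ⊕ coeffAt T₂ e) ⊕ y) (coeffAt-EtaForm T₁-form e) T₃≡ ⟩
    (c ⊗ ηₐ ⊕ coeffAt T₂ e) ⊕ ⊖ c ⊗ ηₐ
      ≡⟨ cancel c ηₐ (coeffAt T₂ e) ⟩
    coeffAt T₂ e
      ≡⟨ T₂≈R e ⟩
    coeffAt R e
      ∎
    where
    open ≡-Reasoning
    open EtaForm
    ηₐ = coeffAt (ls s (η a)) e
    T₃≡ : coeffAt T₃ e ≡ ⊖ c ⊗ ηₐ
    T₃≡ = trans (coeffAt-EtaForm T₃-form e)
                (cong (⊖ c ⊗_) (coeffAt-η-agree s (periodic T₃-form) (periodic T₁-form) agree e))
    cancel : ∀ c x y → (c ⊗ x ⊕ y) ⊕ ⊖ c ⊗ x ≡ y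
    cancel = RingSolver.solve-∀ ℚi-ring

  third-vanishes : ∀ {T₁ T₂ T₃ R s a} → EtaForm T₃ 0i s a → T₁ +L T₂ ≈L R → (T₁ +L T₂) +L T₃ ≈L R
  third-vanishes {T₁} {T₂} {T₃} {R} {s} {a} T₃-form T₁+T₂≈R e = begin
    coeffAt ((T₁ +L T₂) +L T₃) e               ≡⟨ coeffAt-+L (T₁ +L T₂) T₃ e ⟩
    coeffAt (T₁ +L T₂) e ⊕ coeffAt T₃ e        ≡⟨ cong (coeffAt (T₁ +L T₂) e ⊕_) (coeffAt-EtaForm T₃-form e) ⟩
    coeffAt (T₁ +L T₂) e ⊕ 0i ⊗ ηₐ             ≡⟨ cong (coeffAt (T₁ +L T₂) e ⊕_) (⊗-zeroˡ ηₐ) ⟩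
    coeffAt (T₁ +L T₂) e ⊕ 0i                  ≡⟨ ⊕-identityʳ _ ⟩
    coeffAt (T₁ +L T₂) e                       ≡⟨ T₁+T₂≈R e ⟩
    coeffAt R e                                ∎
    where
    open ≡-Reasoning
    ηₐ = coeffAt (ls s (η a)) e

  ≈L-when-first-cancels-third :
    ∀ {T₁ T₂ T₃ R c d s u a b a′ b′} →
    EtaForm T₁ c s a → EtaForm T₂ d u b → EtaForm T₃ (⊖ c) s a′ → EtaForm R d u b′ →
    T (agreeUpTo a′ a (N + p)) → T (agreeUpTo b b′ (N + p)) → (T₁ +L T₂) +L T₃ ≈L R
  ≈L-when-first-cancels-third T₁-form T₂-form T₃-form R-form agree₃ agreeᵣ =
    first-cancels-third T₁-form T₃-form agree₃ (EtaForm-≈L T₂-form R-form agreeᵣ)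

  ≈L-when-third-vanishes :
    ∀ {T₁ T₂ T₃ R c d s u a b x r} →
    EtaForm T₁ c s a → EtaForm T₂ d s b → EtaForm T₃ 0i u x → EtaForm R (c ⊕ d) s r →
    T (agreeUpTo b a (N + p)) → T (agreeUpTo r a (N + p)) → (T₁ +L T₂) +L T₃ ≈L R
  ≈L-when-third-vanishes T₁-form T₂-form T₃-form R-form agree₂ agreeᵣ =
    third-vanishes T₃-form (EtaForm-+L-≈L T₁-form T₂-form R-form agree₂ agreeᵣ)

  tail-EtaForm : ∀ {e b} {e<N : True (suc e ≤? N)} {B∣p : True (suc b ∣? p)} →
    EtaForm (ls (+ 0) (tailPS 1i (suc e) (suc b))) 1i (+ 0) (progression (suc e) (suc b))
  tail-EtaForm {e} {b} {e<N} {B∣p} =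
    etaForm refl (λ n → trans (tailPS-progression e b n) (sym (⊗-identityˡ _)))
            (Periodic-progression (suc e) (suc b) (toWitness e<N) (toWitness B∣p))

  negated-tail-EtaForm : ∀ {e b} {2e<N : True (suc e + suc e ≤? N)} {2B∣p : True (suc b + suc b ∣? p)} →
    EtaForm (ls (+ 0) (tailPS (⊖ 1i) (suc e) (suc b))) 1i (+ 0)
            (progression (suc e + suc e) (suc b + suc b) +E -E progression (suc e) (suc b))
  negated-tail-EtaForm {e} {b} {2e<N} {2B∣p} =
    etaForm refl (λ n → trans (tailPS-negated-progression e b n) (sym (⊗-identityˡ _)))
            (Periodic-+E (Periodic-progression _ _ (toWitness 2e<N) (toWitness 2B∣p))
                         (Periodic-negE (Periodic-progression _ _ e<N B∣p)))
    where
    e<N : suc e ≤ N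
    e<N = ≤-trans (m≤m+n (suc e) (suc e)) (toWitness 2e<N)
    B∣p : suc b ∣ p
    B∣p = ∣-trans (∣m∣n⇒∣m+n ∣-refl ∣-refl) (toWitness 2B∣p)

  1-c-EtaForm : ∀ {c} → EtaForm (oneL -L monoL (mono c (+ 0))) (1i ⊕ ⊖ 1i ⊗ c) (+ 0) 0E
  1-c-EtaForm {c} =
    etaForm refl (λ n → trans (coeffs n) (cong ((1i ⊕ ⊖ 1i ⊗ c) ⊗_) (sym (η-0E n)))) (Periodic-0E {N} {p})
    where
    constant-term : ∀ c → 1i ⊕ ⊖ 1i ⊗ c ≡ (1i ⊕ ⊖ 1i ⊗ c) ⊗ 1i
    constant-term = RingSolver.solve-∀ ℚi-ring
    higher-term : ∀ c → 0i ⊕ ⊖ 1i ⊗ 0i ≡ (1i ⊕ ⊖ 1i ⊗ c) ⊗ 0i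
    higher-term = RingSolver.solve-∀ ℚi-ring
    coeffs : ∀ n → co (oneL -L monoL (mono c (+ 0))) n ≡ (1i ⊕ ⊖ 1i ⊗ c) ⊗ psOne n
    coeffs zero    = constant-term c
    coeffs (suc n) = higher-term c

  1-t⁻²-EtaForm : {2<N : True (2 <? N)} → EtaForm (oneL -L monoL (mono 1i -[1+ 1 ])) (⊖ 1i) -[1+ 1 ] (single 2)
  1-t⁻²-EtaForm {2<N} = etaForm refl (λ n → trans (coeffs n) (cong (⊖ 1i ⊗_) (sym (η-single 1 n))))
                                (Periodic-single 2 (toWitness 2<N))
    where
    coeffs : ∀ n → co (oneL -L monoL (mono 1i -[1+ 1 ])) n ≡ ⊖ 1i ⊗ 1-t^ 2 n
    coeffs 0 = refl
    coeffs 1 = refl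
    coeffs 2 = refl
    coeffs (suc (suc (suc n))) = refl

  1+t⁻²-EtaForm : {4<N : True (4 <? N)} →
    EtaForm (oneL -L monoL (mono (⊖ 1i) -[1+ 1 ])) 1i -[1+ 1 ] (single 4 +E -E single 2)
  1+t⁻²-EtaForm {4<N} =
    etaForm refl (λ n → trans (coeffs n) (cong (1i ⊗_) (η-quotient 1+t² (single 4) (single 2) 1+t²·η≗ n)))
            (Periodic-+E (Periodic-single 4 4<N′) (Periodic-negE (Periodic-single 2 2<N′)))
    where
    4<N′ = toWitness 4<N
    2<N′ = ≤-trans (s≤s (s≤s (s≤s z≤n))) 4<N′
    1+t² = factorPS (⊖ 1i) 2
    1+t²·η≗ : psMul 1+t² (η (single 2)) ≗ η (single 4)
    1+t²·η≗ n = trans (psMul-congʳ 1+t² (η-single 1) n)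
                      (trans (1+t^-difference-of-squares 1 n) (sym (η-single 3 n)))
    coeffs : ∀ n → co (oneL -L monoL (mono (⊖ 1i) -[1+ 1 ])) n ≡ 1i ⊗ 1+t² n
    coeffs 0 = refl
    coeffs 1 = refl
    coeffs 2 = refl
    coeffs (suc (suc (suc n))) = refl

open EtaForms 48 48

-- the exponents of (q^a; q^b)_∞ and of (-q^a; q^b)_∞ = (q^2a; q^2b)_∞ / (q^a; q^b)_∞, in t = q^(1/2)
poch⁺ poch⁻ : ℕ → ℕ → Exponents
poch⁺ a b = progression (2 * a) (2 * b)
poch⁻ a b = progression (4 * a) (4 * b) +E -E progression (2 * a) (2 * b)

-- The arguments of jf are written exactly as they occur in F r (suc r, + 2 ℤ.* + r, …), so that
-- the final comparison with F r is syntactic rather than by evaluation.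

J₁-form : EtaForm (J 1) 1i (+ 0) (poch⁺ 1 1)
J₁-form = tail-EtaForm

J₂-form : EtaForm (J 2) 1i (+ 0) (poch⁺ 2 2)
J₂-form = tail-EtaForm

J₃-form : EtaForm (J 3) 1i (+ 0) (poch⁺ 3 3)
J₃-form = tail-EtaForm

J₄-form : EtaForm (J 4) 1i (+ 0) (poch⁺ 4 4)
J₄-form = tail-EtaForm

J₈-form : EtaForm (J 8) 1i (+ 0) (poch⁺ 8 8)
J₈-form = tail-EtaForm

J₁₂-form : EtaForm (J 12) 1i (+ 0) (poch⁺ 12 12)
J₁₂-form = tail-EtaForm

J₁²-exponents J₂²-exponents : Exponents
J₁²-exponents = poch⁺ 1 1 +E (poch⁺ 1 1 +E 0E)
J₂²-exponents = poch⁺ 2 2 +E (poch⁺ 2 2 +E 0E)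

J₁²-form : EtaForm (J 1 ^L 2) 1i (+ 0) J₁²-exponents
J₁²-form = J₁-form ⋆ (J₁-form ⋆ EtaForm-oneL)

J₁³-form : EtaForm (J 1 ^L 3) 1i (+ 0) (poch⁺ 1 1 +E J₁²-exponents)
J₁³-form = J₁-form ⋆ J₁²-form

J₂²-form : EtaForm (J 2 ^L 2) 1i (+ 0) J₂²-exponents
J₂²-form = J₂-form ⋆ (J₂-form ⋆ EtaForm-oneL)

J₂,₄-form : EtaForm (Jab (+ 2) 4) 1i (+ 0) (poch⁺ 2 4 +E poch⁺ 2 4 +E poch⁺ 4 4)
J₂,₄-form = EtaForm-jf (qp (+ 2)) 4 tail-EtaForm tail-EtaForm tail-EtaForm

J₆,₁₂-form : EtaForm (Jab (+ 6) 12) 1i (+ 0) (poch⁺ 6 12 +E poch⁺ 6 12 +E poch⁺ 12 12)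
J₆,₁₂-form = EtaForm-jf (qp (+ 6)) 12 tail-EtaForm tail-EtaForm tail-EtaForm

j[-q³,q¹²] :
  EtaForm (jf (monoPow (mono (⊖ 1i) (+ 6)) (suc 0)) 12) 1i (+ 0) (poch⁻ 3 12 +E poch⁻ 9 12 +E poch⁺ 12 12)
j[-q³,q¹²] = EtaForm-jf (monoPow (mono (⊖ 1i) (+ 6)) (suc 0)) 12
  negated-tail-EtaForm negated-tail-EtaForm tail-EtaForm

j[q²,q⁸] : EtaForm (jf (qp (+ 2 ℤ.+ + 2 ℤ.* + 0)) 8) 1i (+ 0) (poch⁺ 2 8 +E poch⁺ 6 8 +E poch⁺ 8 8)
j[q²,q⁸] = EtaForm-jf (qp (+ 2 ℤ.+ + 2 ℤ.* + 0)) 8 tail-EtaForm tail-EtaForm tail-EtaForm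

j[-q,q⁴] :
  EtaForm (jf (mono (⊖ 1i) (+ 2 ℤ.* (+ 1 ℤ.- + 0))) 4) 1i (+ 0) (poch⁻ 1 4 +E poch⁻ 3 4 +E poch⁺ 4 4)
j[-q,q⁴] = EtaForm-jf (mono (⊖ 1i) (+ 2 ℤ.* (+ 1 ℤ.- + 0))) 4
  negated-tail-EtaForm negated-tail-EtaForm tail-EtaForm

j[q,q⁴] : EtaForm (jf (qp (+ 1 ℤ.- + 0)) 4) 1i (+ 0) (poch⁺ 1 4 +E poch⁺ 3 4 +E poch⁺ 4 4)
j[q,q⁴] = EtaForm-jf (qp (+ 1 ℤ.- + 0)) 4 tail-EtaForm tail-EtaForm tail-EtaForm

j[q⁶,q¹²] :
  EtaForm (jf (monoPow (mono (⊖ 1i) (+ 6)) (suc 1)) 12) 1i (+ 0) (poch⁺ 6 12 +E poch⁺ 6 12 +E poch⁺ 12 12)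
j[q⁶,q¹²] = EtaForm-jf (monoPow (mono (⊖ 1i) (+ 6)) (suc 1)) 12
  tail-EtaForm tail-EtaForm tail-EtaForm

j[q⁴,q⁸] : EtaForm (jf (qp (+ 2 ℤ.+ + 2 ℤ.* + 1)) 8) 1i (+ 0) (poch⁺ 4 8 +E poch⁺ 4 8 +E poch⁺ 8 8)
j[q⁴,q⁸] = EtaForm-jf (qp (+ 2 ℤ.+ + 2 ℤ.* + 1)) 8 tail-EtaForm tail-EtaForm tail-EtaForm

j[-1,q⁴] :
  EtaForm (jf (mono (⊖ 1i) (+ 2 ℤ.* (+ 1 ℤ.- + 1))) 4) (1i ⊕ 1i) (+ 0) (poch⁻ 4 4 +E poch⁻ 4 4 +E poch⁺ 4 4)
j[-1,q⁴] = EtaForm-jf (mono (⊖ 1i) (+ 2 ℤ.* (+ 1 ℤ.- + 1))) 4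
  (1-c-EtaForm ⋆ negated-tail-EtaForm) negated-tail-EtaForm tail-EtaForm

j[1,q⁴] : EtaForm (jf (qp (+ 1 ℤ.- + 1)) 4) 0i (+ 0) (poch⁺ 4 4 +E poch⁺ 4 4 +E poch⁺ 4 4)
j[1,q⁴] = EtaForm-jf (qp (+ 1 ℤ.- + 1)) 4 (1-c-EtaForm ⋆ tail-EtaForm) tail-EtaForm tail-EtaForm

j[-q⁹,q¹²] :
  EtaForm (jf (monoPow (mono (⊖ 1i) (+ 6)) (suc 2)) 12) 1i (+ 0) (poch⁻ 9 12 +E poch⁻ 3 12 +E poch⁺ 12 12)
j[-q⁹,q¹²] = EtaForm-jf (monoPow (mono (⊖ 1i) (+ 6)) (suc 2)) 12
  negated-tail-EtaForm negated-tail-EtaForm tail-EtaForm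

j[q⁶,q⁸] : EtaForm (jf (qp (+ 2 ℤ.+ + 2 ℤ.* + 2)) 8) 1i (+ 0) (poch⁺ 6 8 +E poch⁺ 2 8 +E poch⁺ 8 8)
j[q⁶,q⁸] = EtaForm-jf (qp (+ 2 ℤ.+ + 2 ℤ.* + 2)) 8 tail-EtaForm tail-EtaForm tail-EtaForm

j[-q⁻¹,q⁴] : EtaForm (jf (mono (⊖ 1i) (+ 2 ℤ.* (+ 1 ℤ.- + 2))) 4) 1i -[1+ 1 ]
                     (single 4 +E -E single 2 +E poch⁻ 3 4 +E poch⁻ 5 4 +E poch⁺ 4 4)
j[-q⁻¹,q⁴] = EtaForm-jf (mono (⊖ 1i) (+ 2 ℤ.* (+ 1 ℤ.- + 2))) 4
  (1+t⁻²-EtaForm ⋆ negated-tail-EtaForm) negated-tail-EtaForm tail-EtaForm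

j[q⁻¹,q⁴] :
  EtaForm (jf (qp (+ 1 ℤ.- + 2)) 4) (⊖ 1i) -[1+ 1 ] (single 2 +E poch⁺ 3 4 +E poch⁺ 5 4 +E poch⁺ 4 4)
j[q⁻¹,q⁴] = EtaForm-jf (qp (+ 1 ℤ.- + 2)) 4 (1-t⁻²-EtaForm ⋆ tail-EtaForm) tail-EtaForm tail-EtaForm

F-at-0 : F 0 ≈L ℚL (+ 1 / 4) *L ((J 1 ^L 2) *L J 2 /L J 4)
F-at-0 = ≈L-when-first-cancels-third
  (EtaForm-monoL ((mono (⊖ iu) (+ 0) ⊛ monoPow (monoInv iq32) 0) ⊛ qhalf (+ 1))
     ⋆ (J₁³-form ⋆ j[-q³,q¹²]) ⊘ (J₂,₄-form ⋆ J₆,₁₂-form))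
  (EtaForm-ℚL (+ 1 / 4) ⋆ (J₁³-form ⊘ J₂²-form)
     ⋆ (EtaForm-monoL (qp (ℤ.- (+ 0))) ⋆ (j[q²,q⁸] ⊘ J₈-form) ⋆ j[-q,q⁴]))
  (EtaForm-*L
     (EtaForm-monoL (monoInv iq32)
        ⋆ (EtaForm-monoL (qp (+ 2)) ⋆ (J₁²-form ⋆ J₄-form ⋆ J₁₂-form) ⊘ (J₂²-form ⋆ J₃-form)))
     (EtaForm-·L (⊖ 1i) (EtaForm-monoL (qp (ℤ.- (+ 0))) ⋆ (j[q²,q⁸] ⊘ J₈-form)) ⋆ j[q,q⁴]))
  (EtaForm-ℚL (+ 1 / 4) ⋆ (J₁²-form ⋆ J₂-form ⊘ J₄-form))
  tt tt

F-at-1 : F 1 ≈L ℚL (+ 1 / 2) *L monoL (monoInv (qp (+ 1))) *L (-L ((J 1 ^L 3) *L J 4 /L (J 2 ^L 2)))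
F-at-1 = ≈L-when-third-vanishes
  (EtaForm-monoL ((mono (⊖ iu) (+ 0) ⊛ monoPow (monoInv iq32) 1) ⊛ qhalf (+ 1))
     ⋆ (J₁³-form ⋆ j[q⁶,q¹²]) ⊘ (J₂,₄-form ⋆ J₆,₁₂-form))
  (EtaForm-*L
     (EtaForm-ℚL (+ 1 / 4) ⋆ (J₁³-form ⊘ J₂²-form))
     (EtaForm-*L (EtaForm-monoL (qp (ℤ.- (+ 1))) ⋆ (j[q⁴,q⁸] ⊘ J₈-form)) j[-1,q⁴]))
  (EtaForm-*L
     (EtaForm-monoL (monoInv iq32)
        ⋆ (EtaForm-monoL (qp (+ 2)) ⋆ (J₁²-form ⋆ J₄-form ⋆ J₁₂-form) ⊘ (J₂²-form ⋆ J₃-form)))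
     (EtaForm-*L (EtaForm-·L (⊖ 1i) (EtaForm-monoL (qp (ℤ.- (+ 1))) ⋆ (j[q⁴,q⁸] ⊘ J₈-form))) j[1,q⁴]))
  (EtaForm-*L
     (EtaForm-ℚL (+ 1 / 2) ⋆ EtaForm-monoL (monoInv (qp (+ 1))))
     (EtaForm-·L (⊖ 1i) (J₁³-form ⋆ J₄-form ⊘ J₂²-form)))
  tt tt

F-at-2 : F 2 ≈L ℚL (+ 1 / 4) *L monoL (monoInv (qp (+ 3))) *L ((J 1 ^L 2) *L J 2 /L J 4)
F-at-2 = ≈L-when-first-cancels-third
  (EtaForm-monoL ((mono (⊖ iu) (+ 0) ⊛ monoPow (monoInv iq32) 2) ⊛ qhalf (+ 1))
     ⋆ (J₁³-form ⋆ j[-q⁹,q¹²]) ⊘ (J₂,₄-form ⋆ J₆,₁₂-form))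
  (EtaForm-ℚL (+ 1 / 4) ⋆ (J₁³-form ⊘ J₂²-form)
     ⋆ (EtaForm-monoL (qp (ℤ.- (+ 2))) ⋆ (j[q⁶,q⁸] ⊘ J₈-form) ⋆ j[-q⁻¹,q⁴]))
  (EtaForm-*L
     (EtaForm-monoL (monoInv iq32)
        ⋆ (EtaForm-monoL (qp (+ 2)) ⋆ (J₁²-form ⋆ J₄-form ⋆ J₁₂-form) ⊘ (J₂²-form ⋆ J₃-form)))
     (EtaForm-*L (EtaForm-·L (⊖ 1i) (EtaForm-monoL (qp (ℤ.- (+ 2))) ⋆ (j[q⁶,q⁸] ⊘ J₈-form))) j[q⁻¹,q⁴]))
  (EtaForm-ℚL (+ 1 / 4) ⋆ EtaForm-monoL (monoInv (qp (+ 3))) ⋆ (J₁²-form ⋆ J₂-form ⊘ J₄-form))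
  tt tt

proposition6p2 : (F 0 ≈L ℚL (+ 1 / 4) *L ((J 1 ^L 2) *L J 2 /L J 4))
    × (F 1 ≈L ℚL (+ 1 / 2) *L monoL (monoInv (qp (+ 1))) *L (-L ((J 1 ^L 3) *L J 4 /L (J 2 ^L 2))))
    × (F 2 ≈L ℚL (+ 1 / 4) *L monoL (monoInv (qp (+ 3))) *L ((J 1 ^L 2) *L J 2 /L J 4))
proposition6p2 = F-at-0 , F-at-1 , F-at-2
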